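{- For each $\theta>0$ such that $h=\frac1\theta$ is an integer, each tree $t$ has some $(10,\theta)$-bounded partition hierarchy.
   Context: Trees are finite ordered unranked trees; $n$ is a size parameter with $t$ having at most $n$ nodes. A zone of $t$ is a set $S$ of nodes forming a subforest of $t$ whose roots are consecutive siblings, such that every $v\in S$ has either none or all of its children in $S$, and at most one node of $S$ has children in $t$ none of which are in $S$. For an integer $\ell\ge1$, an $\ell$-zone is a zone with at most $n^{\theta\ell}$ nodes; the whole tree is an $h$-zone. Partition hierarchies are defined inductively: if $S$ is a 2-zone and $S_1,\dots,S_k$ are 1-zones forming a partition of $S$, then $(S,\{S_1,\dots,S_k\})$ is a partition hierarchy of height 2 for $S$; if $S$ is an $(\ell+1)$-zone, $\{S_1,\dots,S_k\}$ is a partition of $S$ into $\ell$-zones and each $H_j$ is a partition hierarchy of height $\ell$ for $S_j$, then $(S,\{H_1,\dots,H_k\})$ is a partition hierarchy of height $\ell+1$ for $S$. A partition hierarchy of $t$ is one of height $h$ for the zone consisting of all of $t$. It is $(c,\theta)$-bounded if every partition of a zone occurring in it consists of at most $c n^\theta$ zones. -}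

module Defs where

open import Data.Nat using (ℕ; zero; suc; _+_; _*_; _^_; _≤_; _<_)
open import Data.List using (List; []; _∷_; _++_; [_]; length; lookup)
open import Data.List.Membership.Propositional using (_∈_; _∉_)
open import Data.List.Relation.Unary.All using (All)
open import Data.List.Relation.Unary.Unique.Propositional using (Unique)
open import Data.Fin using (Fin)
open import Data.Product using (Σ; ∃; _×_; _,_)
open import Data.Sum using (_⊎_)
open import Relation.Binary.PropositionalEquality using (_≡_; _≢_)

-- Finite ordered unranked trees (node labels from an arbitrary set A;
-- labels play no role in the notions below).

data Tree (A : Set) : Set where
  node : A → List (Tree A) → Tree A

mutual
  size : {A : Set} → Tree A → ℕ
  size (node _ ts) = suc (sizes ts)

  sizes : {A : Set} → List (Tree A) → ℕ
  sizes [] = 0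
  sizes (t ∷ ts) = size t + sizes ts

-- Nodes are addressed by their path from the root: the root is [],
-- and the i-th child (0-based) of the node at address p is p ++ [ i ].
Addr : Set
Addr = List ℕ

children : {A : Set} → Tree A → List (Tree A)
children (node _ ts) = ts

data ChildAt {A : Set} : List (Tree A) → ℕ → Tree A → Set where
  here  : ∀ {t ts} → ChildAt (t ∷ ts) zero t
  there : ∀ {t ts i u} → ChildAt ts i u → ChildAt (t ∷ ts) (suc i) u

data At {A : Set} : Tree A → Addr → Tree A → Set where
  root : ∀ {t} → At t [] t
  down : ∀ {a ts i c p u} → ChildAt ts i c → At c p u → At (node a ts) (i ∷ p) u

Node : {A : Set} → Tree A → Addr → Set
Node t v = ∃ λ u → At t v u

IsChild : {A : Set} → Tree A → Addr → Addr → Set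
IsChild t v w = Σ ℕ λ i → (w ≡ v ++ [ i ]) × Node t w

-- Sets of nodes are duplicate-free lists of addresses.

-- the roots of S (nodes of S whose parent is not in S) are the
-- consecutive siblings p++[a], ..., p++[b-1] (a < b), or S contains the
-- root of t (then the root of t is the only root of S).
SubforestConsecutiveRoots : Addr → List Addr → Set
SubforestConsecutiveRoots p S =
  Σ ℕ λ a → Σ ℕ λ b → a < b ×
    (∀ i → a ≤ i → i < b → (p ++ [ i ]) ∈ S) ×
    (∀ v → v ∈ S →
       (Σ ℕ λ i → a ≤ i × i < b × v ≡ p ++ [ i ])
       ⊎ (Σ Addr λ w → Σ ℕ λ i → v ≡ w ++ [ i ] × w ∈ S))

SubforestAtRoot : List Addr → Set
SubforestAtRoot S =
  ([] ∈ S) ×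
  (∀ v → v ∈ S → (v ≡ []) ⊎ (Σ Addr λ w → Σ ℕ λ i → v ≡ w ++ [ i ] × w ∈ S))

Hole : {A : Set} → Tree A → List Addr → Addr → Set
Hole t S v = v ∈ S × (∃ λ w → IsChild t v w) × (∀ w → IsChild t v w → w ∉ S)

record Zone {A : Set} (t : Tree A) (S : List Addr) : Set where
  field
    unique    : Unique S
    nodes     : All (Node t) S
    nonempty  : S ≢ []
    subforest : SubforestAtRoot S ⊎ (Σ Addr λ p → SubforestConsecutiveRoots p S)
    allOrNone : ∀ v → v ∈ S →
                  (∀ w → IsChild t v w → w ∈ S) ⊎ (∀ w → IsChild t v w → w ∉ S)
    atMostOneHole : ∀ u v → Hole t S u → Hole t S v → u ≡ v

-- ℓ-zone for θ = 1/h:  |S| ≤ n^(ℓ/h)  ⟺  |S|^h ≤ n^ℓ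
LZone : {A : Set} → Tree A → (n h ℓ : ℕ) → List Addr → Set
LZone t n h ℓ S = Zone t S × (length S ^ h ≤ n ^ ℓ)

data Hier : Set where
  mk : List Addr → List Hier → Hier

top : Hier → List Addr
top (mk S _) = S

Partition : List Addr → List Hier → Set
Partition S Hs =
  (∀ v → v ∈ S → Σ (Fin (length Hs)) λ j → v ∈ top (lookup Hs j)) ×
  (∀ j v → v ∈ top (lookup Hs j) → v ∈ S) ×
  (∀ i j v → v ∈ top (lookup Hs i) → v ∈ top (lookup Hs j) → i ≡ j)

-- Height 1 is the base case
-- "a 1-zone alone"; this makes height 2 exactly the paper's base case.
data IsPH {A : Set} (t : Tree A) (n h : ℕ) : ℕ → Hier → Set where
  ph1 : ∀ {S} → LZone t n h 1 S → IsPH t n h 1 (mk S [])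
  phS : ∀ {ℓ S Hs} → LZone t n h (suc ℓ) S → Partition S Hs →
        All (IsPH t n h ℓ) Hs → IsPH t n h (suc ℓ) (mk S Hs)

-- (c,θ)-bounded, θ = 1/h: every partition has k ≤ c n^(1/h) parts,
-- i.e. k^h ≤ c^h * n
data Bounded (n h c : ℕ) : Hier → Set where
  bnd : ∀ {S Hs} → length Hs ^ h ≤ c ^ h * n → All (Bounded n h c) Hs →
        Bounded n h c (mk S Hs)

-- Zones are represented by clusters: a run of consecutive sibling subtrees (or the whole tree)
-- from which the part strictly below at most one hole is cut off. The core is a partition lemma:
-- for K ≥ 1, a cluster with m nodes splits into clusters of 1 to K nodes, and K times their number
-- is at most 5m + 3K. It is proved bottom-up: every node hands an open cluster of at most K nodes
-- with at most one hole to its parent, which either absorbs the open clusters of its children or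
-- closes them, grouping them greedily into runs of consecutive siblings; a potential of 2K per open
-- hole pays for the groups. With K = ⌊n^(ℓ/h)⌋ this gives at most 10 n^(1/h) parts per zone, and
-- the hierarchy is built by recursion on the height.

module Submission where

open import Defs
open import Data.Bool using (Bool; true; false; _∧_; _∨_; not)
open import Data.Bool.Properties using (T-≡; ∧-zeroʳ; ∧-identityʳ; ∨-identityʳ; ∨-assoc; ∧-conicalˡ; ∧-conicalʳ)
open import Data.Nat
open import Data.Nat.Properties
open import Data.Nat.Solver using (module +-*-Solver)
open import Data.List using (List; []; _∷_; _++_; [_]; length; map; lookup; take; drop; filterᵇ; initLast; _∷ʳ′_)
open import Data.List.Properties using (∷-injectiveʳ; ++-assoc; ++-identityʳ; ++-identityʳ-unique; ++-cancelˡ; length-++; length-map)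
open import Data.List.Membership.Propositional using (_∈_; _∉_)
open import Data.List.Membership.Propositional.Properties using (∈-filter⁺; ∈-filter⁻; ∈-map⁺; ∈-map⁻; ∈-++⁺ˡ; ∈-++⁺ʳ; ∈-++⁻)
open import Data.List.Relation.Unary.Any using (here; there)
open import Data.List.Relation.Unary.All as All using (All; []; _∷_)
import Data.List.Relation.Unary.All.Properties as All
open import Data.List.Relation.Unary.AllPairs using ([]; _∷_)
open import Data.List.Relation.Unary.Unique.Propositional using (Unique)
import Data.List.Relation.Unary.Unique.Propositional.Properties as Unique
open import Data.Fin using (Fin; zero; suc)
open import Data.Maybe using (Maybe; just; nothing; _<∣>_)
open import Data.Maybe.Properties using (just-injective)
open import Data.Product using (Σ; ∃; _×_; _,_; proj₁; proj₂)
open import Data.Sum using (_⊎_; inj₁; inj₂)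
open import Data.Empty using (⊥; ⊥-elim)
open import Data.Unit using (⊤; tt)
open import Relation.Nullary using (¬_; yes; no)
open import Relation.Nullary.Decidable using (T?)
open import Function using (_∘_)
open import Function.Bundles using (Equivalence)
open import Relation.Binary.PropositionalEquality hiding ([_])
open +-*-Solver using (solve; _:+_; _:*_; _:=_; con)

infix 4.5 _≼ᵇ_ _≺ᵇ_ _==_

_≼ᵇ_ : Addr → Addr → Bool
[]      ≼ᵇ w       = true
(i ∷ v) ≼ᵇ []      = false
(i ∷ v) ≼ᵇ (j ∷ w) = (i ≡ᵇ j) ∧ (v ≼ᵇ w)

_≺ᵇ_ : Addr → Addr → Bool
[]      ≺ᵇ []      = false
[]      ≺ᵇ (_ ∷ _) = true
(i ∷ v) ≺ᵇ []      = false
(i ∷ v) ≺ᵇ (j ∷ w) = (i ≡ᵇ j) ∧ (v ≺ᵇ w)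

_==_ : Addr → Addr → Bool
[]      == []      = true
[]      == (_ ∷ _) = false
(_ ∷ _) == []      = false
(i ∷ v) == (j ∷ w) = (i ≡ᵇ j) ∧ (v == w)

true≢false : true ≢ false
true≢false ()

≡ᵇ-sound : ∀ i j → (i ≡ᵇ j) ≡ true → i ≡ j
≡ᵇ-sound zero    zero    _ = refl
≡ᵇ-sound (suc i) (suc j) e = cong suc (≡ᵇ-sound i j e)

≡ᵇ-refl : ∀ i → (i ≡ᵇ i) ≡ true
≡ᵇ-refl zero    = refl
≡ᵇ-refl (suc i) = ≡ᵇ-refl i

≼ᵇ-++ : ∀ v q → v ≼ᵇ v ++ q ≡ true
≼ᵇ-++ []      q = refl
≼ᵇ-++ (i ∷ v) q rewrite ≡ᵇ-refl i = ≼ᵇ-++ v q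

≼ᵇ-refl : ∀ v → v ≼ᵇ v ≡ true
≼ᵇ-refl v = subst (λ w → v ≼ᵇ w ≡ true) (++-identityʳ v) (≼ᵇ-++ v [])

≼ᵇ-sound : ∀ v w → v ≼ᵇ w ≡ true → Σ Addr λ q → w ≡ v ++ q
≼ᵇ-sound []      w       _ = w , refl
≼ᵇ-sound (i ∷ v) (j ∷ w) e
  with ≡ᵇ-sound i j (∧-conicalˡ _ _ e) | ≼ᵇ-sound v w (∧-conicalʳ _ _ e)
... | refl | q , refl = q , refl

≺ᵇ-++ : ∀ x j q → x ≺ᵇ x ++ j ∷ q ≡ true
≺ᵇ-++ []      j q = refl
≺ᵇ-++ (i ∷ x) j q rewrite ≡ᵇ-refl i = ≺ᵇ-++ x j q

≺ᵇ-sound : ∀ x w → x ≺ᵇ w ≡ true → Σ ℕ λ j → Σ Addr λ q → w ≡ x ++ j ∷ q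
≺ᵇ-sound []      (j ∷ w) _ = j , w , refl
≺ᵇ-sound (i ∷ x) (j ∷ w) e
  with ≡ᵇ-sound i j (∧-conicalˡ _ _ e) | ≺ᵇ-sound x w (∧-conicalʳ _ _ e)
... | refl | k , q , refl = k , q , refl

==-refl : ∀ v → v == v ≡ true
==-refl []      = refl
==-refl (i ∷ v) rewrite ≡ᵇ-refl i = ==-refl v

==-sound : ∀ v w → v == w ≡ true → v ≡ w
==-sound []      []      _ = refl
==-sound (i ∷ v) (j ∷ w) e
  with ≡ᵇ-sound i j (∧-conicalˡ _ _ e) | ==-sound v w (∧-conicalʳ _ _ e)
... | refl | refl = refl

==-false : ∀ v w → v ≢ w → v == w ≡ false
==-false v w v≢w with v == w in e
... | true  = ⊥-elim (v≢w (==-sound v w e))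
... | false = refl

≢-++-∷ : ∀ (v : Addr) j q → v ≢ v ++ j ∷ q
≢-++-∷ v j q e with ++-identityʳ-unique v e
... | ()

==-++-∷ : ∀ v j q → v == v ++ j ∷ q ≡ false
==-++-∷ v j q = ==-false v (v ++ j ∷ q) (≢-++-∷ v j q)

≼ᵇ-extend : ∀ v w q → v ≼ᵇ w ≡ true → v ≼ᵇ w ++ q ≡ true
≼ᵇ-extend v w q e with ≼ᵇ-sound v w e
... | r , refl rewrite ++-assoc v r q = ≼ᵇ-++ v (r ++ q)

≺ᵇ-extend : ∀ x w q → x ≺ᵇ w ≡ true → x ≺ᵇ w ++ q ≡ true
≺ᵇ-extend x w q e with ≺ᵇ-sound x w e
... | j , r , refl rewrite ++-assoc x (j ∷ r) q = ≺ᵇ-++ x j (r ++ q)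

≺ᵇ-snoc : ∀ x v i → x ≺ᵇ v ++ [ i ] ≡ x ≼ᵇ v
≺ᵇ-snoc []            []      i = refl
≺ᵇ-snoc []            (_ ∷ v) i = refl
≺ᵇ-snoc (j ∷ [])      []      i = ∧-zeroʳ (j ≡ᵇ i)
≺ᵇ-snoc (j ∷ (_ ∷ _)) []      i = ∧-zeroʳ (j ≡ᵇ i)
≺ᵇ-snoc (j ∷ x)       (l ∷ v) i = cong ((j ≡ᵇ l) ∧_) (≺ᵇ-snoc x v i)

≼ᵇ∧⊀ᵇ⇒≡ : ∀ x u → x ≼ᵇ u ≡ true → x ≺ᵇ u ≡ false → x ≡ u
≼ᵇ∧⊀ᵇ⇒≡ []      []      _  _ = refl
≼ᵇ∧⊀ᵇ⇒≡ (j ∷ x) (l ∷ u) e₁ e₂ with ≡ᵇ-sound j l (∧-conicalˡ _ _ e₁)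
... | refl rewrite ≡ᵇ-refl j = cong (j ∷_) (≼ᵇ∧⊀ᵇ⇒≡ x u (∧-conicalʳ _ _ e₁) e₂)

≼ᵇ⇒⊀ᵇ : ∀ v x → v ≼ᵇ x ≡ true → x ≺ᵇ v ≡ false
≼ᵇ⇒⊀ᵇ v x e with x ≺ᵇ v in e′
... | false = refl
... | true with ≼ᵇ-sound v x e | ≺ᵇ-sound x v e′
...   | q , refl | l , r , v≡ =
  ⊥-elim (++-∷-≢-[] q (++-identityʳ-unique v (trans v≡ (++-assoc v q (l ∷ r)))))
  where
  ++-∷-≢-[] : ∀ q → q ++ l ∷ r ≢ []
  ++-∷-≢-[] []      ()
  ++-∷-≢-[] (_ ∷ _) ()

child≼ᵇ-sound : ∀ y i w → y ++ [ i ] ≼ᵇ w ≡ true → Σ Addr λ q → w ≡ y ++ i ∷ q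
child≼ᵇ-sound y i w e with ≼ᵇ-sound (y ++ [ i ]) w e
... | q , refl = q , ++-assoc y [ i ] q

child≼ᵇ-++ : ∀ y i q → y ++ [ i ] ≼ᵇ y ++ i ∷ q ≡ true
child≼ᵇ-++ y i q = subst (λ z → y ++ [ i ] ≼ᵇ z ≡ true) (++-assoc y [ i ] q) (≼ᵇ-++ (y ++ [ i ]) q)

++-∷-injectiveˡ : ∀ (y : Addr) {i j a b} → y ++ i ∷ a ≡ y ++ j ∷ b → i ≡ j
++-∷-injectiveˡ y e with ++-cancelˡ y _ _ e
... | refl = refl

child≼ᵇ-unique : ∀ y i j w → y ++ [ i ] ≼ᵇ w ≡ true → y ++ [ j ] ≼ᵇ w ≡ true → i ≡ j
child≼ᵇ-unique y i j w e₁ e₂ with child≼ᵇ-sound y i w e₁ | child≼ᵇ-sound y j w e₂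
... | q₁ , refl | q₂ , e = ++-∷-injectiveˡ y e

≺ᵇ-apart : ∀ y i j w x → y ++ [ i ] ≼ᵇ w ≡ true → y ++ [ j ] ≼ᵇ x ≡ true → i ≢ j → x ≺ᵇ w ≡ false
≺ᵇ-apart y i j w x e₁ e₂ i≢j with x ≺ᵇ w in e₃
... | false = refl
... | true with ≺ᵇ-sound x w e₃ | child≼ᵇ-sound y j x e₂ | child≼ᵇ-sound y i w e₁
...   | l , q , refl | r , refl | q₁ , e₄ =
  ⊥-elim (i≢j (sym (++-∷-injectiveˡ y (trans (sym (++-assoc y (j ∷ r) (l ∷ q))) e₄))))

underSiblings : Addr → ℕ → ℕ → Addr → Bool
underSiblings y s zero    w = false
underSiblings y s (suc k) w = (y ++ [ s ] ≼ᵇ w) ∨ underSiblings y (suc s) k w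

∨-true : ∀ {a b} → (a ∨ b) ≡ true → a ≡ true ⊎ b ≡ true
∨-true {true}  _ = inj₁ refl
∨-true {false} e = inj₂ e

underSiblings-sound : ∀ y s k w → underSiblings y s k w ≡ true →
  Σ ℕ λ j → s ≤ j × j < s + k × y ++ [ j ] ≼ᵇ w ≡ true
underSiblings-sound y s (suc k) w e with ∨-true {y ++ [ s ] ≼ᵇ w} e
... | inj₁ e₁ = s , ≤-refl , m<m+n s (s≤s z≤n) , e₁
... | inj₂ e₂ with underSiblings-sound y (suc s) k w e₂
...   | j , s<j , j<s+k , e₃ = j , <⇒≤ s<j , subst (j <_) (sym (+-suc s k)) j<s+k , e₃

underSiblings-complete : ∀ y s k w j → s ≤ j → j < s + k → y ++ [ j ] ≼ᵇ w ≡ true →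
  underSiblings y s k w ≡ true
underSiblings-complete y s zero w j s≤j j<s+k _ =
  ⊥-elim (<-irrefl refl (≤-<-trans s≤j (subst (j <_) (+-identityʳ s) j<s+k)))
underSiblings-complete y s (suc k) w j s≤j j<s+k e with y ++ [ s ] ≼ᵇ w in e′
... | true = refl
... | false with m≤n⇒m<n∨m≡n s≤j
...   | inj₂ refl = ⊥-elim (true≢false (trans (sym e) e′))
...   | inj₁ s<j  = underSiblings-complete y (suc s) k w j s<j (subst (j <_) (+-suc s k) j<s+k) e

underSiblings-≼ᵇ : ∀ y s k w → underSiblings y s k w ≡ true → y ≼ᵇ w ≡ true
underSiblings-≼ᵇ y s k w e with underSiblings-sound y s k w e
... | j , _ , _ , e₁ with child≼ᵇ-sound y j w e₁
...   | q , refl = ≼ᵇ-++ y (j ∷ q)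

underSiblings-extend : ∀ y s k w q → underSiblings y s k w ≡ true → underSiblings y s k (w ++ q) ≡ true
underSiblings-extend y s k w q e with underSiblings-sound y s k w e
... | j , s≤j , j<s+k , e₁ = underSiblings-complete y s k (w ++ q) j s≤j j<s+k (≼ᵇ-extend (y ++ [ j ]) w q e₁)

underSiblings-snoc : ∀ y s k w →
  underSiblings y s (suc k) w ≡ (underSiblings y s k w ∨ (y ++ [ s + k ] ≼ᵇ w))
underSiblings-snoc y s zero w rewrite +-identityʳ s = ∨-identityʳ _
underSiblings-snoc y s (suc k) w rewrite underSiblings-snoc y (suc s) k w | +-suc s k =
  sym (∨-assoc (y ++ [ s ] ≼ᵇ w) (underSiblings y (suc s) k w) (y ++ [ suc (s + k) ] ≼ᵇ w))

underSiblings-self : ∀ v s k → underSiblings v s k v ≡ false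
underSiblings-self v s k with underSiblings v s k v in e
... | false = refl
... | true with underSiblings-sound v s k v e
...   | j , _ , _ , e₁ with child≼ᵇ-sound v j v e₁
...     | q , v≡ = ⊥-elim (≢-++-∷ v j q v≡)

toℕ : Bool → ℕ
toℕ true  = 1
toℕ false = 0

toℕ≤1 : ∀ b → toℕ b ≤ 1
toℕ≤1 true  = ≤-refl
toℕ≤1 false = z≤n

toℕ≥1 : ∀ {b} → 1 ≤ toℕ b → b ≡ true
toℕ≥1 {true} _ = refl

toℕ-true : ∀ {b} → b ≡ true → toℕ b ≡ 1
toℕ-true refl = refl

toℕ-∨-∧ : ∀ a b c → (a ≡ true → b ≡ true → ⊥) → toℕ ((a ∨ b) ∧ c) ≡ toℕ (a ∧ c) + toℕ (b ∧ c)
toℕ-∨-∧ true  true  c     disj = ⊥-elim (disj refl refl)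
toℕ-∨-∧ true  false true  disj = refl
toℕ-∨-∧ true  false false disj = refl
toℕ-∨-∧ false b     c     disj = refl

toℕ-underSiblings-suc : ∀ y s k w c →
  toℕ (underSiblings y s (suc k) w ∧ c) ≡ toℕ ((y ++ [ s ] ≼ᵇ w) ∧ c) + toℕ (underSiblings y (suc s) k w ∧ c)
toℕ-underSiblings-suc y s k w c = toℕ-∨-∧ _ _ c first-apart
  where
  first-apart : y ++ [ s ] ≼ᵇ w ≡ true → underSiblings y (suc s) k w ≡ true → ⊥
  first-apart e₁ e₂ with underSiblings-sound y (suc s) k w e₂
  ... | j , s<j , _ , e₃ = <-irrefl (child≼ᵇ-unique y s j w e₁ e₃) s<j

toℕ-underSiblings-snoc : ∀ y s k w c →
  toℕ (underSiblings y s (suc k) w ∧ c) ≡ toℕ (underSiblings y s k w ∧ c) + toℕ ((y ++ [ s + k ] ≼ᵇ w) ∧ c)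
toℕ-underSiblings-snoc y s k w c rewrite underSiblings-snoc y s k w = toℕ-∨-∧ _ _ c last-apart
  where
  last-apart : underSiblings y s k w ≡ true → y ++ [ s + k ] ≼ᵇ w ≡ true → ⊥
  last-apart e₁ e₂ with underSiblings-sound y s k w e₁
  ... | j , _ , j<s+k , e₃ = <-irrefl (child≼ᵇ-unique y j (s + k) w e₃ e₂) j<s+k

<-suc-elim : ∀ {P : ℕ → Set} k → (∀ j → j < k → P j) → P k → ∀ j → j < suc k → P j
<-suc-elim k below at-k j (s≤s j≤k) with m≤n⇒m<n∨m≡n j≤k
... | inj₁ j<k  = below j j<k
... | inj₂ refl = at-k

∧-cong-true : ∀ a {b c} → (a ≡ true → b ≡ c) → a ∧ b ≡ a ∧ c
∧-cong-true true  b≡c = b≡c refl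
∧-cong-true false _   = refl

belowHole : Maybe Addr → Addr → Bool
belowHole nothing  w = false
belowHole (just x) w = x ≺ᵇ w

subtreeCut : Addr → Maybe Addr → Addr → Bool
subtreeCut v X w = (v ≼ᵇ w) ∧ not (belowHole X w)

not-true : ∀ {a} → not a ≡ true → a ≡ false
not-true {false} _ = refl

belowHole-prefix : ∀ X w q → belowHole X (w ++ q) ≡ false → belowHole X w ≡ false
belowHole-prefix nothing  w q e = refl
belowHole-prefix (just x) w q e with x ≺ᵇ w in e′
... | false = refl
... | true  = ⊥-elim (true≢false (trans (sym (≺ᵇ-extend x w q e′)) e))

belowHole-[] : ∀ X → belowHole X [] ≡ false
belowHole-[] nothing         = refl
belowHole-[] (just [])       = refl
belowHole-[] (just (_ ∷ _))  = refl

HoleBelow : Addr → Maybe Addr → Set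
HoleBelow v X = ∀ {x} → X ≡ just x → v ≼ᵇ x ≡ true

HoleInside : Addr → ℕ → ℕ → Maybe Addr → Set
HoleInside y s k X = ∀ {x} → X ≡ just x → underSiblings y s k x ≡ true

belowHole-apart : ∀ y i j X w → y ++ [ i ] ≼ᵇ w ≡ true → HoleBelow (y ++ [ j ]) X → i ≢ j → belowHole X w ≡ false
belowHole-apart y i j nothing  w _ _     _   = refl
belowHole-apart y i j (just x) w e x-below i≢j = ≺ᵇ-apart y i j w x e (x-below refl) i≢j

belowHole-root : ∀ v X → HoleBelow v X → belowHole X v ≡ false
belowHole-root v nothing  _   = refl
belowHole-root v (just x) v≼x = ≼ᵇ⇒⊀ᵇ v x (v≼x refl)

mutual
  nodes : {A : Set} → Tree A → List Addr
  nodes (node a cs) = [] ∷ nodesFrom 0 cs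

  nodesFrom : {A : Set} → ℕ → List (Tree A) → List Addr
  nodesFrom i []       = []
  nodesFrom i (c ∷ cs) = map (i ∷_) (nodes c) ++ nodesFrom (suc i) cs

mutual
  length-nodes : {A : Set} (t : Tree A) → length (nodes t) ≡ size t
  length-nodes (node a cs) = cong suc (length-nodesFrom 0 cs)

  length-nodesFrom : {A : Set} (i : ℕ) (cs : List (Tree A)) → length (nodesFrom i cs) ≡ sizes cs
  length-nodesFrom i []       = refl
  length-nodesFrom i (c ∷ cs) = trans (length-++ (map (i ∷_) (nodes c)))
    (cong₂ _+_ (trans (length-map (i ∷_) (nodes c)) (length-nodes c)) (length-nodesFrom (suc i) cs))

mutual
  nodes-sound : {A : Set} (t : Tree A) {w : Addr} → w ∈ nodes t → Node t w
  nodes-sound (node a cs) (here refl) = node a cs , root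
  nodes-sound (node a cs) (there p) with nodesFrom-sound 0 cs p
  ... | j , q , c , refl , ch , q∈ with nodes-sound c q∈
  ...   | u , at = u , down ch at

  nodesFrom-sound : {A : Set} (i : ℕ) (cs : List (Tree A)) {w : Addr} → w ∈ nodesFrom i cs →
    Σ ℕ λ j → Σ Addr λ q → Σ (Tree A) λ c → w ≡ (i + j) ∷ q × ChildAt cs j c × q ∈ nodes c
  nodesFrom-sound i (c ∷ cs) p with ∈-++⁻ (map (i ∷_) (nodes c)) p
  ... | inj₁ p₁ with ∈-map⁻ (i ∷_) p₁
  ...   | q , q∈ , refl = 0 , q , c , cong (_∷ q) (sym (+-identityʳ i)) , here , q∈
  nodesFrom-sound i (c ∷ cs) p | inj₂ p₂ with nodesFrom-sound (suc i) cs p₂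
  ... | j , q , c′ , refl , ch , q∈ = suc j , q , c′ , cong (_∷ q) (sym (+-suc i j)) , there ch , q∈

mutual
  nodes-complete : {A : Set} (t : Tree A) {w : Addr} {u : Tree A} → At t w u → w ∈ nodes t
  nodes-complete (node a cs) root       = here refl
  nodes-complete (node a cs) (down ch at) = there (nodesFrom-complete 0 cs ch at)

  nodesFrom-complete : {A : Set} (i : ℕ) (cs : List (Tree A)) {j : ℕ} {c : Tree A} {q : Addr} {u : Tree A} →
    ChildAt cs j c → At c q u → (i + j) ∷ q ∈ nodesFrom i cs
  nodesFrom-complete i (c ∷ cs) {q = q} here at =
    subst (λ k → k ∷ q ∈ nodesFrom i (c ∷ cs)) (sym (+-identityʳ i))
      (∈-++⁺ˡ (∈-map⁺ (i ∷_) (nodes-complete c at)))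
  nodesFrom-complete i (c ∷ cs) {j = suc j} {q = q} (there ch) at =
    subst (λ k → k ∷ q ∈ nodesFrom i (c ∷ cs)) (sym (+-suc i j))
      (∈-++⁺ʳ (map (i ∷_) (nodes c)) (nodesFrom-complete (suc i) cs ch at))

nodesFrom-head : {A : Set} (i : ℕ) (cs : List (Tree A)) {j : ℕ} {q : Addr} → j ∷ q ∈ nodesFrom i cs → i ≤ j
nodesFrom-head i cs p with nodesFrom-sound i cs p
... | k , q , c , refl , _ = m≤m+n i k

mutual
  nodes-unique : {A : Set} (t : Tree A) → Unique (nodes t)
  nodes-unique (node a cs) = All.tabulate []∉ ∷ nodesFrom-unique 0 cs
    where
    []∉ : ∀ {w} → w ∈ nodesFrom 0 cs → [] ≢ w
    []∉ p refl with nodesFrom-sound 0 cs p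
    ... | _ , _ , _ , () , _

  nodesFrom-unique : {A : Set} (i : ℕ) (cs : List (Tree A)) → Unique (nodesFrom i cs)
  nodesFrom-unique i []       = []
  nodesFrom-unique i (c ∷ cs) =
    Unique.++⁺ (Unique.map⁺ ∷-injectiveʳ (nodes-unique c)) (nodesFrom-unique (suc i) cs) apart
    where
    apart : ∀ {v} → ¬ (v ∈ map (i ∷_) (nodes c) × v ∈ nodesFrom (suc i) cs)
    apart (p₁ , p₂) with ∈-map⁻ (i ∷_) p₁
    ... | q , _ , refl = 1+n≰n (nodesFrom-head (suc i) cs p₂)

sumOver : (Addr → ℕ) → List Addr → ℕ
sumOver f []       = 0
sumOver f (x ∷ xs) = f x + sumOver f xs

count : (Addr → Bool) → List Addr → ℕ
count P = sumOver (λ w → toℕ (P w))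

sumOver-cong : ∀ f g L → (∀ w → w ∈ L → f w ≡ g w) → sumOver f L ≡ sumOver g L
sumOver-cong f g []       f≗g = refl
sumOver-cong f g (x ∷ xs) f≗g = cong₂ _+_ (f≗g x (here refl)) (sumOver-cong f g xs (λ w p → f≗g w (there p)))

sumOver-+ : ∀ f g L → sumOver (λ w → f w + g w) L ≡ sumOver f L + sumOver g L
sumOver-+ f g []       = refl
sumOver-+ f g (x ∷ xs) rewrite sumOver-+ f g xs =
  solve 4 (λ a b c d → a :+ b :+ (c :+ d) := a :+ c :+ (b :+ d)) refl (f x) (g x) (sumOver f xs) (sumOver g xs)

sumOver-zero : ∀ f L → (∀ w → w ∈ L → f w ≡ 0) → sumOver f L ≡ 0
sumOver-zero f []       f≗0 = refl
sumOver-zero f (x ∷ xs) f≗0 rewrite f≗0 x (here refl) = sumOver-zero f xs (λ w p → f≗0 w (there p))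

count-== : ∀ v L → Unique L → v ∈ L → count (v ==_) L ≡ 1
count-== v (x ∷ xs) (v∉ ∷ _) (here refl) rewrite ==-refl v =
  cong suc (sumOver-zero _ xs λ w p → cong toℕ (==-false v w (All.lookup v∉ p)))
count-== v (x ∷ xs) (x∉ ∷ u) (there p)
  rewrite ==-false v x (λ v≡x → All.lookup x∉ (subst (_∈ xs) v≡x p) refl) = count-== v xs u p

length-filterᵇ : ∀ P L → length (filterᵇ P L) ≡ count P L
length-filterᵇ P []       = refl
length-filterᵇ P (x ∷ xs) with P x
... | true  = cong suc (length-filterᵇ P xs)
... | false = length-filterᵇ P xs

ChildAt-det : {A : Set} {cs : List (Tree A)} {i : ℕ} {c c′ : Tree A} → ChildAt cs i c → ChildAt cs i c′ → c ≡ c′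
ChildAt-det here      here      = refl
ChildAt-det (there p) (there q) = ChildAt-det p q

ChildAt-< : {A : Set} {cs : List (Tree A)} {i : ℕ} {c : Tree A} → ChildAt cs i c → i < length cs
ChildAt-< here      = s≤s z≤n
ChildAt-< (there p) = s≤s (ChildAt-< p)

At-prefix : {A : Set} {t : Tree A} (v q : Addr) {u : Tree A} → At t (v ++ q) u → Node t v
At-prefix []      q at           = _ , root
At-prefix (i ∷ v) q (down ch at) with At-prefix v q at
... | u , at′ = u , down ch at′

At-child : {A : Set} {t : Tree A} (v : Addr) {a : A} {cs : List (Tree A)} {i : ℕ} {c : Tree A} →
  At t v (node a cs) → ChildAt cs i c → At t (v ++ [ i ]) c
At-child []      root          ch = down ch root
At-child (j ∷ v) (down ch′ at) ch = down ch′ (At-child v at ch)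

At-parent : {A : Set} {t : Tree A} (y : Addr) (i : ℕ) {u : Tree A} → At t (y ++ [ i ]) u →
  Σ A λ a → Σ (List (Tree A)) λ cs → At t y (node a cs) × ChildAt cs i u
At-parent []      i (down {a = a} {ts = ts} ch root) = a , ts , root , ch
At-parent (j ∷ y) i (down ch at) with At-parent y i at
... | a , cs , at′ , ch′ = a , cs , down ch at′ , ch′

At-child-< : {A : Set} {t : Tree A} (v : Addr) {a : A} {cs : List (Tree A)} (j : ℕ) (q : Addr) {u : Tree A} →
  At t v (node a cs) → At t (v ++ j ∷ q) u → j < length cs
At-child-< []      j q root            (down ch _)     = ChildAt-< ch
At-child-< (k ∷ v) j q (down ch₁ at₁) (down ch₂ at₂) with ChildAt-det ch₁ ch₂
... | refl = At-child-< v j q at₁ at₂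

slice-ChildAt : {A : Set} (s k : ℕ) (cs : List (Tree A)) {j : ℕ} {c : Tree A} →
  ChildAt (take k (drop s cs)) j c → ChildAt cs (s + j) c
slice-ChildAt zero    (suc k) (c ∷ cs) here      = here
slice-ChildAt zero    (suc k) (c ∷ cs) (there p) = there (slice-ChildAt zero k cs p)
slice-ChildAt (suc s) k       (c ∷ cs) p         = there (slice-ChildAt s k cs p)
slice-ChildAt (suc s) zero    []       ()
slice-ChildAt (suc s) (suc k) []       ()

length-slice : {A : Set} (s k : ℕ) (cs : List (Tree A)) → s + k ≤ length cs → length (take k (drop s cs)) ≡ k
length-slice zero    zero    cs       _         = refl
length-slice zero    (suc k) (c ∷ cs) (s≤s le)  = cong suc (length-slice zero k cs le)
length-slice (suc s) k       (c ∷ cs) (s≤s le)  = length-slice s k cs le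

slice-index-< : {A : Set} (s k : ℕ) (cs : List (Tree A)) {j : ℕ} {c : Tree A} →
  ChildAt (take k (drop s cs)) j c → j < k
slice-index-< zero    (suc k) (c ∷ cs) here      = s≤s z≤n
slice-index-< zero    (suc k) (c ∷ cs) (there p) = s≤s (slice-index-< zero k cs p)
slice-index-< (suc s) k       (c ∷ cs) p         = slice-index-< s k cs p
slice-index-< (suc s) zero    []       ()
slice-index-< (suc s) (suc k) []       ()

-- A cluster consists of the nodes below its roots (the whole tree, or the children s, …, s+k−1
-- of y) that are not strictly below its hole.
data Cluster : Set where
  wholeTree : Maybe Addr → Cluster
  siblings  : Addr → ℕ → ℕ → Maybe Addr → Cluster

hole : Cluster → Maybe Addr
hole (wholeTree X)      = X
hole (siblings _ _ _ X) = X

⟦_⟧ : Cluster → Addr → Bool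
⟦ wholeTree X ⟧      w = not (belowHole X w)
⟦ siblings y s k X ⟧ w = underSiblings y s k w ∧ not (belowHole X w)

holeAtOrAbove : Maybe Addr → Addr → Bool
holeAtOrAbove nothing  v = false
holeAtOrAbove (just x) v = x ≼ᵇ v

belowHole-snoc : ∀ X v i → belowHole X (v ++ [ i ]) ≡ holeAtOrAbove X v
belowHole-snoc nothing  v i = refl
belowHole-snoc (just x) v i = ≺ᵇ-snoc x v i

⟦⟧-child : ∀ C v i → ⟦ C ⟧ v ≡ true → ⟦ C ⟧ (v ++ [ i ]) ≡ not (holeAtOrAbove (hole C) v)
⟦⟧-child (wholeTree X) v i _ = cong not (belowHole-snoc X v i)
⟦⟧-child (siblings y s k X) v i e
  rewrite underSiblings-extend y s k v [ i ] (∧-conicalˡ _ _ e) = cong not (belowHole-snoc X v i)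

⟦⟧-notBelowHole : ∀ C w → ⟦ C ⟧ w ≡ true → belowHole (hole C) w ≡ false
⟦⟧-notBelowHole (wholeTree X)      w e = not-true e
⟦⟧-notBelowHole (siblings y s k X) w e = not-true (∧-conicalʳ _ _ e)

⟦⟧-hole : ∀ C u → holeAtOrAbove (hole C) u ≡ true → belowHole (hole C) u ≡ false → hole C ≡ just u
⟦⟧-hole C u e₁ e₂ with hole C
... | just x = cong just (≼ᵇ∧⊀ᵇ⇒≡ x u e₁ e₂)

multiplicity : List Cluster → Addr → ℕ
multiplicity []       w = 0
multiplicity (C ∷ Cs) w = toℕ (⟦ C ⟧ w) + multiplicity Cs w

multiplicity-++ : ∀ Cs Ds w → multiplicity (Cs ++ Ds) w ≡ multiplicity Cs w + multiplicity Ds w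
multiplicity-++ []       Ds w = refl
multiplicity-++ (C ∷ Cs) Ds w rewrite multiplicity-++ Cs Ds w =
  sym (+-assoc (toℕ (⟦ C ⟧ w)) (multiplicity Cs w) (multiplicity Ds w))

module ClusterZones {A : Set} (t : Tree A) where

  nodesWhere : (Addr → Bool) → List Addr
  nodesWhere P = filterᵇ P (nodes t)

  ∈-nodesWhere⁺ : ∀ P {w} → Node t w → P w ≡ true → w ∈ nodesWhere P
  ∈-nodesWhere⁺ P (_ , at) e = ∈-filter⁺ (T? ∘ P) (nodes-complete t at) (Equivalence.from T-≡ e)

  ∈-nodesWhere⁻ : ∀ P {w} → w ∈ nodesWhere P → Node t w × P w ≡ true
  ∈-nodesWhere⁻ P p with ∈-filter⁻ (T? ∘ P) p
  ... | w∈ , Pw = nodes-sound t w∈ , Equivalence.to T-≡ Pw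

  WellFormed : Cluster → Set
  WellFormed (wholeTree X)      = ⊤
  WellFormed (siblings y s k X) =
    1 ≤ k × (∀ j → j < k → Node t (y ++ [ s + j ]) × belowHole X (y ++ [ s + j ]) ≡ false)

  ⟦_⟧ᴺ : Cluster → List Addr
  ⟦ C ⟧ᴺ = nodesWhere ⟦ C ⟧

  root-∈-wholeTree : ∀ X → [] ∈ ⟦ wholeTree X ⟧ᴺ
  root-∈-wholeTree X = ∈-nodesWhere⁺ _ (t , root) (cong not (belowHole-[] X))

  root-∈-siblings : ∀ y s k X → WellFormed (siblings y s k X) →
    ∀ i → s ≤ i → i < s + k → y ++ [ i ] ∈ ⟦ siblings y s k X ⟧ᴺ
  root-∈-siblings y s k X (_ , roots) i s≤i i<s+k
    with roots (i ∸ s) (subst (i ∸ s <_) (m+n∸m≡n s k) (∸-monoˡ-< i<s+k s≤i))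
  ... | nd , notBelow rewrite m+[n∸m]≡n s≤i =
    ∈-nodesWhere⁺ _ nd (cong₂ _∧_ (underSiblings-complete y s k _ i s≤i i<s+k (child≼ᵇ-++ y i [])) (cong not notBelow))

  parent-∈ : ∀ C w i → Node t (w ++ [ i ]) → ⟦ C ⟧ (w ++ [ i ]) ≡ true →
    (∀ {y s k X} → C ≡ siblings y s k X → underSiblings y s k w ≡ true) → w ∈ ⟦ C ⟧ᴺ
  parent-∈ (wholeTree X) w i nd e _ =
    ∈-nodesWhere⁺ _ (At-prefix w [ i ] (proj₂ nd)) (cong not (belowHole-prefix X w [ i ] (not-true e)))
  parent-∈ (siblings y s k X) w i nd e w-under = ∈-nodesWhere⁺ _ (At-prefix w [ i ] (proj₂ nd))
    (cong₂ _∧_ (w-under refl) (cong not (belowHole-prefix X w [ i ] (not-true (∧-conicalʳ _ _ e)))))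

  ⟦⟧ᴺ-nonempty : ∀ C → WellFormed C → ⟦ C ⟧ᴺ ≢ []
  ⟦⟧ᴺ-nonempty (wholeTree X) _ e with subst ([] ∈_) e (root-∈-wholeTree X)
  ... | ()
  ⟦⟧ᴺ-nonempty (siblings y s k X) wf@(1≤k , _) e
    with subst (y ++ [ s ] ∈_) e (root-∈-siblings y s k X wf s ≤-refl (m<m+n s 1≤k))
  ... | ()

  subforest-wholeTree : ∀ X → SubforestAtRoot ⟦ wholeTree X ⟧ᴺ
  subforest-wholeTree X = root-∈-wholeTree X , has-parent
    where
    has-parent : ∀ v → v ∈ ⟦ wholeTree X ⟧ᴺ →
      (v ≡ []) ⊎ (Σ Addr λ w → Σ ℕ λ i → v ≡ w ++ [ i ] × w ∈ ⟦ wholeTree X ⟧ᴺ)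
    has-parent v p with initLast v
    ... | []       = inj₁ refl
    ... | w ∷ʳ′ i with ∈-nodesWhere⁻ _ p
    ...   | nd , e = inj₂ (w , i , refl , parent-∈ (wholeTree X) w i nd e (λ ()))

  subforest-siblings : ∀ y s k X → WellFormed (siblings y s k X) →
    SubforestConsecutiveRoots y ⟦ siblings y s k X ⟧ᴺ
  subforest-siblings y s k X wf@(1≤k , _) =
    s , s + k , m<m+n s 1≤k , root-∈-siblings y s k X wf , root-or-parent
    where
    C = siblings y s k X
    root-or-parent : ∀ v → v ∈ ⟦ C ⟧ᴺ →
      (Σ ℕ λ i → s ≤ i × i < s + k × v ≡ y ++ [ i ]) ⊎ (Σ Addr λ w → Σ ℕ λ i → v ≡ w ++ [ i ] × w ∈ ⟦ C ⟧ᴺ)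
    root-or-parent v p with ∈-nodesWhere⁻ _ p
    ... | nd , e with underSiblings-sound y s k v (∧-conicalˡ _ _ e)
    ... | j , s≤j , j<s+k , e₁ with child≼ᵇ-sound y j v e₁
    ... | q , refl with initLast q
    ... | []       = inj₁ (j , s≤j , j<s+k , refl)
    ... | q′ ∷ʳ′ l = inj₂ (y ++ j ∷ q′ , l , v≡ , parent-∈ C (y ++ j ∷ q′) l (subst (Node t) v≡ nd)
                            (subst (λ z → ⟦ C ⟧ z ≡ true) v≡ e)
                            (λ { refl → underSiblings-complete y s k _ j s≤j j<s+k (child≼ᵇ-++ y j q′) }))
      where
      v≡ : y ++ j ∷ (q′ ++ [ l ]) ≡ (y ++ j ∷ q′) ++ [ l ]
      v≡ = sym (++-assoc y (j ∷ q′) [ l ])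

  ⟦⟧ᴺ-allOrNone : ∀ C v → v ∈ ⟦ C ⟧ᴺ →
    (∀ w → IsChild t v w → w ∈ ⟦ C ⟧ᴺ) ⊎ (∀ w → IsChild t v w → w ∉ ⟦ C ⟧ᴺ)
  ⟦⟧ᴺ-allOrNone C v p with ∈-nodesWhere⁻ _ p
  ... | _ , e with holeAtOrAbove (hole C) v in e′
  ... | false = inj₁ λ { w (i , refl , nd) → ∈-nodesWhere⁺ _ nd (trans (⟦⟧-child C v i e) (cong not e′)) }
  ... | true  = inj₂ λ { w (i , refl , nd) p′ →
    true≢false (trans (sym (proj₂ (∈-nodesWhere⁻ _ p′))) (trans (⟦⟧-child C v i e) (cong not e′))) }

  Hole⇒hole : ∀ C u → Hole t ⟦ C ⟧ᴺ u → hole C ≡ just u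
  Hole⇒hole C u (p , (w , i , refl , nd) , none) with ∈-nodesWhere⁻ _ p
  ... | _ , e with holeAtOrAbove (hole C) u in e′
  ... | false = ⊥-elim (none w (i , refl , nd) (∈-nodesWhere⁺ _ nd (trans (⟦⟧-child C u i e) (cong not e′))))
  ... | true  = ⟦⟧-hole C u e′ (⟦⟧-notBelowHole C u e)

  ⟦⟧-zone : ∀ C → WellFormed C → Zone t ⟦ C ⟧ᴺ
  ⟦⟧-zone C wf = record
    { unique        = Unique.filter⁺ (T? ∘ ⟦ C ⟧) (nodes-unique t)
    ; nodes         = All.tabulate (λ p → proj₁ (∈-nodesWhere⁻ _ p))
    ; nonempty      = ⟦⟧ᴺ-nonempty C wf
    ; subforest     = subforest C wf
    ; allOrNone     = ⟦⟧ᴺ-allOrNone C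
    ; atMostOneHole = λ u v hu hv → just-injective (trans (sym (Hole⇒hole C u hu)) (Hole⇒hole C v hv))
    }
    where
    subforest : ∀ C → WellFormed C →
      SubforestAtRoot ⟦ C ⟧ᴺ ⊎ (Σ Addr λ p → SubforestConsecutiveRoots p ⟦ C ⟧ᴺ)
    subforest (wholeTree X)      _  = inj₁ (subforest-wholeTree X)
    subforest (siblings y s k X) wf = inj₂ (y , subforest-siblings y s k X wf)

  data TopsDenote : List Hier → List Cluster → Set where
    []  : TopsDenote [] []
    _∷_ : ∀ {H C Hs Cs} → top H ≡ ⟦ C ⟧ᴺ → TopsDenote Hs Cs → TopsDenote (H ∷ Hs) (C ∷ Cs)

  index-of : ∀ {Hs Cs} → TopsDenote Hs Cs → ∀ {w} → Node t w → 1 ≤ multiplicity Cs w →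
    Σ (Fin (length Hs)) λ j → w ∈ top (lookup Hs j)
  index-of (_∷_ {C = C} e ds) {w} nd m≥1 with ⟦ C ⟧ w in e′
  ... | true  = zero , subst (w ∈_) (sym e) (∈-nodesWhere⁺ _ nd e′)
  ... | false with index-of ds nd m≥1
  ...   | j , p = suc j , p

  multiplicity-≥1 : ∀ {Hs Cs} → TopsDenote Hs Cs → ∀ j {w} → w ∈ top (lookup Hs j) →
    Node t w × 1 ≤ multiplicity Cs w
  multiplicity-≥1 (_∷_ {C = C} e ds) zero {w} p with ∈-nodesWhere⁻ ⟦ C ⟧ (subst (w ∈_) e p)
  ... | nd , e′ = nd , ≤-trans (≤-reflexive (sym (toℕ-true e′))) (m≤m+n _ _)
  multiplicity-≥1 (e ∷ ds) (suc j) p with multiplicity-≥1 ds j p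
  ... | nd , m≥1 = nd , ≤-trans m≥1 (m≤n+m _ _)

  head-tail-disjoint : ∀ {H C Hs Cs} → top H ≡ ⟦ C ⟧ᴺ → TopsDenote Hs Cs → ∀ j {w} → w ∈ top H → w ∈ top (lookup Hs j) →
    multiplicity (C ∷ Cs) w ≤ 1 → ⊥
  head-tail-disjoint {C = C} {Cs = Cs} e ds j {w} p q m≤1 with multiplicity-≥1 ds j q
  ... | _ , m≥1 = 1+n≰n (≤-trans (s≤s m≥1) (subst (_≤ 1) (cong (_+ multiplicity Cs w) here≡1) m≤1))
    where
    here≡1 : toℕ (⟦ C ⟧ w) ≡ 1
    here≡1 = toℕ-true (proj₂ (∈-nodesWhere⁻ ⟦ C ⟧ (subst (w ∈_) e p)))

  index-unique : ∀ {Hs Cs} → TopsDenote Hs Cs → ∀ i j {w} → w ∈ top (lookup Hs i) → w ∈ top (lookup Hs j) →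
    multiplicity Cs w ≤ 1 → i ≡ j
  index-unique (e ∷ ds) zero    zero    p q m≤1 = refl
  index-unique (_∷_ {H} {C} e ds) zero    (suc j) p q m≤1 = ⊥-elim (head-tail-disjoint {H} {C} e ds j p q m≤1)
  index-unique (_∷_ {H} {C} e ds) (suc i) zero    p q m≤1 = ⊥-elim (head-tail-disjoint {H} {C} e ds i q p m≤1)
  index-unique (_∷_ {C = C} e ds) (suc i) (suc j) {w} p q m≤1 =
    cong suc (index-unique ds i j p q (≤-trans (m≤n+m _ (toℕ (⟦ C ⟧ w))) m≤1))

  partition-by-multiplicity : (P : Addr → Bool) {Hs : List Hier} {Cs : List Cluster} → TopsDenote Hs Cs →
    (∀ w → Node t w → multiplicity Cs w ≡ toℕ (P w)) → Partition (nodesWhere P) Hs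
  partition-by-multiplicity P {Hs} ds m≡ = cover , within , disjoint
    where
    cover : ∀ v → v ∈ nodesWhere P → Σ (Fin (length Hs)) λ j → v ∈ top (lookup Hs j)
    cover v p with ∈-nodesWhere⁻ P p
    ... | nd , e = index-of ds nd (≤-reflexive (sym (trans (m≡ v nd) (toℕ-true e))))
    within : ∀ j v → v ∈ top (lookup Hs j) → v ∈ nodesWhere P
    within j v p with multiplicity-≥1 ds j p
    ... | nd , m≥1 = ∈-nodesWhere⁺ P nd (toℕ≥1 (≤-trans m≥1 (≤-reflexive (m≡ v nd))))
    disjoint : ∀ i j v → v ∈ top (lookup Hs i) → v ∈ top (lookup Hs j) → i ≡ j
    disjoint i j v p q with multiplicity-≥1 ds i p
    ... | nd , _ = index-unique ds i j p q (≤-trans (≤-reflexive (m≡ v nd)) (toℕ≤1 (P v)))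

  ∣_∣ : Cluster → ℕ
  ∣ C ∣ = count ⟦ C ⟧ (nodes t)

  ∥_∥ : List Cluster → ℕ
  ∥ []     ∥ = 0
  ∥ C ∷ Cs ∥ = ∣ C ∣ + ∥ Cs ∥

  ∥∥-++ : ∀ Cs Ds → ∥ Cs ++ Ds ∥ ≡ ∥ Cs ∥ + ∥ Ds ∥
  ∥∥-++ []       Ds = refl
  ∥∥-++ (C ∷ Cs) Ds rewrite ∥∥-++ Cs Ds = sym (+-assoc ∣ C ∣ ∥ Cs ∥ ∥ Ds ∥)

  ∥∥-multiplicity : ∀ Cs → ∥ Cs ∥ ≡ sumOver (multiplicity Cs) (nodes t)
  ∥∥-multiplicity []       = sym (sumOver-zero _ (nodes t) (λ _ _ → refl))
  ∥∥-multiplicity (C ∷ Cs) = trans (cong (∣ C ∣ +_) (∥∥-multiplicity Cs))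
                                   (sym (sumOver-+ (λ w → toℕ (⟦ C ⟧ w)) (multiplicity Cs) (nodes t)))

data Siblings (P : Addr → Set) (y : Addr) : ℕ → Set where
  []  : ∀ {s} → Siblings P y s
  _∷_ : ∀ {s} → P (y ++ [ s ]) → Siblings P y (suc s) → Siblings P y s

siblingCount : ∀ {P : Addr → Set} {y s} → Siblings P y s → ℕ
siblingCount []       = 0
siblingCount (_ ∷ ps) = suc (siblingCount ps)

mapSiblings : ∀ {P Q : Addr → Set} {y s} → (∀ {v} → P v → Q v) → Siblings P y s → Siblings Q y s
mapSiblings f []       = []
mapSiblings f (p ∷ ps) = f p ∷ mapSiblings f ps

siblingCount-map : ∀ {P Q : Addr → Set} {y s} (f : ∀ {v} → P v → Q v) (ps : Siblings P y s) →
  siblingCount (mapSiblings f ps) ≡ siblingCount ps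
siblingCount-map f []       = refl
siblingCount-map f (p ∷ ps) = cong suc (siblingCount-map f ps)

holeCount : Maybe Addr → ℕ
holeCount nothing  = 0
holeCount (just _) = 1

data AtMostOneHole : Maybe Addr → Maybe Addr → Set where
  left-free  : ∀ {X′} → AtMostOneHole nothing X′
  right-free : ∀ {x}  → AtMostOneHole (just x) nothing

atMostOneHole? : ∀ X X′ → AtMostOneHole X X′ ⊎ (holeCount X ≡ 1 × holeCount X′ ≡ 1)
atMostOneHole? nothing  X′       = inj₁ left-free
atMostOneHole? (just x) nothing  = inj₁ right-free
atMostOneHole? (just x) (just _) = inj₂ (refl , refl)

mergedHole : ∀ {X X′} → AtMostOneHole X X′ → Maybe Addr
mergedHole {X′ = X′} left-free  = X′
mergedHole {X = X}   right-free = X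

holeCount-merged : ∀ {X X′} (m : AtMostOneHole X X′) → holeCount (mergedHole m) ≡ holeCount X + holeCount X′
holeCount-merged left-free  = refl
holeCount-merged right-free = refl

module Grouping {A : Set} (t : Tree A) (K : ℕ) where
  open ClusterZones t

  cutSize : Addr → Maybe Addr → ℕ
  cutSize v X = count (subtreeCut v X) (nodes t)

  Sized : Cluster → Set
  Sized C = 1 ≤ ∣ C ∣ × ∣ C ∣ ≤ K

  record Piece (v : Addr) : Set where
    field
      cut      : Maybe Addr
      isNode   : Node t v
      cutBelow : HoleBelow v cut
      nonempty : 1 ≤ cutSize v cut
      small    : cutSize v cut ≤ K

  Pieces : Addr → ℕ → Set
  Pieces = Siblings Piece

  piecesAt : ∀ {y s} → Pieces y s → Addr → ℕ
  piecesAt             []       w = 0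
  piecesAt {y} {s} (p ∷ ps) w = toℕ (subtreeCut (y ++ [ s ]) (Piece.cut p) w) + piecesAt ps w

  piecesSize : ∀ {y s} → Pieces y s → ℕ
  piecesSize             []       = 0
  piecesSize {y} {s} (p ∷ ps) = cutSize (y ++ [ s ]) (Piece.cut p) + piecesSize ps

  piecesHoles : ∀ {y s} → Pieces y s → ℕ
  piecesHoles []       = 0
  piecesHoles (p ∷ ps) = holeCount (Piece.cut p) + piecesHoles ps

  sumOver-piecesAt : ∀ {y s} (ps : Pieces y s) → sumOver (piecesAt ps) (nodes t) ≡ piecesSize ps
  sumOver-piecesAt             []       = sumOver-zero _ (nodes t) (λ _ _ → refl)
  sumOver-piecesAt {y} {s} (p ∷ ps) =
    trans (sumOver-+ (λ w → toℕ (subtreeCut (y ++ [ s ]) (Piece.cut p) w)) (piecesAt ps) (nodes t))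
          (cong (cutSize (y ++ [ s ]) (Piece.cut p) +_) (sumOver-piecesAt ps))

  ⟦single⟧ : ∀ y s X w → toℕ (⟦ siblings y s 1 X ⟧ w) ≡ toℕ (subtreeCut (y ++ [ s ]) X w)
  ⟦single⟧ y s X w rewrite ∨-identityʳ (y ++ [ s ] ≼ᵇ w) = refl

  ∣single∣ : ∀ y s X → ∣ siblings y s 1 X ∣ ≡ cutSize (y ++ [ s ]) X
  ∣single∣ y s X = sumOver-cong _ _ (nodes t) (λ w _ → ⟦single⟧ y s X w)

  ⟦⟧-extend : ∀ y s₀ k {X X′} (m : AtMostOneHole X X′) → HoleInside y s₀ k X →
    HoleBelow (y ++ [ s₀ + k ]) X′ → ∀ w →
    toℕ (⟦ siblings y s₀ (suc k) (mergedHole m) ⟧ w)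
      ≡ toℕ (⟦ siblings y s₀ k X ⟧ w) + toℕ (subtreeCut (y ++ [ s₀ + k ]) X′ w)
  ⟦⟧-extend y s₀ k {X′ = X′} left-free _ X′-below w
    rewrite toℕ-underSiblings-snoc y s₀ k w (not (belowHole X′ w)) =
    cong (_+ toℕ (subtreeCut (y ++ [ s₀ + k ]) X′ w)) (cong toℕ (∧-cong-true _ (λ e → cong not (earlier-free e))))
    where
    earlier-free : underSiblings y s₀ k w ≡ true → belowHole X′ w ≡ false
    earlier-free e with underSiblings-sound y s₀ k w e
    ... | j , _ , j<s₀+k , e₁ = belowHole-apart y j (s₀ + k) X′ w e₁ X′-below (λ j≡ → <-irrefl j≡ j<s₀+k)
  ⟦⟧-extend y s₀ k {X = just x} right-free x-inside _ w
    rewrite toℕ-underSiblings-snoc y s₀ k w (not (x ≺ᵇ w)) =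
    cong (toℕ (⟦ siblings y s₀ k (just x) ⟧ w) +_) (cong toℕ (∧-cong-true _ (λ e → cong not (last-free e))))
    where
    last-free : y ++ [ s₀ + k ] ≼ᵇ w ≡ true → x ≺ᵇ w ≡ false
    last-free e with underSiblings-sound y s₀ k x (x-inside refl)
    ... | j , _ , j<s₀+k , e₁ =
      belowHole-apart y (s₀ + k) j (just x) w e (λ { refl → e₁ }) (λ j≡ → <-irrefl (sym j≡) j<s₀+k)

  WellFormed-extend : ∀ y s₀ k {X X′} (m : AtMostOneHole X X′) → WellFormed (siblings y s₀ k X) →
    HoleInside y s₀ k X → Node t (y ++ [ s₀ + k ]) → HoleBelow (y ++ [ s₀ + k ]) X′ →
    WellFormed (siblings y s₀ (suc k) (mergedHole m))
  WellFormed-extend y s₀ k {X′ = X′} left-free (_ , roots) _ nd X′-below =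
    s≤s z≤n , <-suc-elim k old-root (nd , belowHole-root (y ++ [ s₀ + k ]) X′ X′-below)
    where
    old-root : ∀ j → j < k → Node t (y ++ [ s₀ + j ]) × belowHole X′ (y ++ [ s₀ + j ]) ≡ false
    old-root j j<k = proj₁ (roots j j<k) ,
      belowHole-apart y (s₀ + j) (s₀ + k) X′ _ (child≼ᵇ-++ y (s₀ + j) []) X′-below
        (λ eq → <-irrefl (+-cancelˡ-≡ s₀ j k eq) j<k)
  WellFormed-extend y s₀ k {X = X} right-free (_ , roots) X-inside nd _ =
    s≤s z≤n , <-suc-elim k roots (nd , new-root)
    where
    new-root : belowHole X (y ++ [ s₀ + k ]) ≡ false
    new-root with underSiblings-sound y s₀ k _ (X-inside refl)
    ... | j , _ , j<s₀+k , e₁ = belowHole-apart y (s₀ + k) j X _ (child≼ᵇ-++ y (s₀ + k) []) (λ { refl → e₁ })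
                                  (λ j≡ → <-irrefl (sym j≡) j<s₀+k)

  HoleInside-extend : ∀ y s₀ k {X X′} (m : AtMostOneHole X X′) → HoleInside y s₀ k X →
    HoleBelow (y ++ [ s₀ + k ]) X′ → HoleInside y s₀ (suc k) (mergedHole m)
  HoleInside-extend y s₀ k left-free _ X′-below {x} refl =
    underSiblings-complete y s₀ (suc k) x (s₀ + k) (m≤m+n s₀ k) (+-monoʳ-< s₀ ≤-refl) (X′-below refl)
  HoleInside-extend y s₀ k {X = just x} right-free X-inside _ refl
    rewrite underSiblings-snoc y s₀ k x | X-inside refl = refl

  ∣extend∣ : ∀ y s₀ k {X X′} (m : AtMostOneHole X X′) → HoleInside y s₀ k X → HoleBelow (y ++ [ s₀ + k ]) X′ →
    ∣ siblings y s₀ (suc k) (mergedHole m) ∣ ≡ ∣ siblings y s₀ k X ∣ + cutSize (y ++ [ s₀ + k ]) X′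
  ∣extend∣ y s₀ k {X} {X′} m X-inside X′-below =
    trans (sumOver-cong _ _ (nodes t) (λ w _ → ⟦⟧-extend y s₀ k m X-inside X′-below w))
          (sumOver-+ (λ w → toℕ (⟦ siblings y s₀ k X ⟧ w)) (λ w → toℕ (subtreeCut (y ++ [ s₀ + k ]) X′ w)) (nodes t))

  record Run (y : Addr) (s₀ k : ℕ) (X : Maybe Addr) : Set where
    field
      wellFormed : WellFormed (siblings y s₀ k X)
      holeInside : HoleInside y s₀ k X
      sized      : Sized (siblings y s₀ k X)

  Run-single : ∀ {y s} (p : Piece (y ++ [ s ])) → Run y s 1 (Piece.cut p)
  Run-single {y} {s} p = record
    { wellFormed = s≤s z≤n , λ { zero (s≤s z≤n) → subst (λ z → Node t (y ++ [ z ]) × belowHole cut (y ++ [ z ]) ≡ false)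
                                                    (sym (+-identityʳ s)) (isNode , belowHole-root _ cut cutBelow) }
    ; holeInside = λ e → cong (_∨ false) (cutBelow e)
    ; sized      = subst (λ z → 1 ≤ z × z ≤ K) (sym (∣single∣ y s cut)) (nonempty , small)
    }
    where open Piece p

  Run-extend : ∀ {y s₀ k X} → Run y s₀ k X → (p : Piece (y ++ [ s₀ + k ])) →
    ∣ siblings y s₀ k X ∣ + cutSize (y ++ [ s₀ + k ]) (Piece.cut p) ≤ K →
    (m : AtMostOneHole X (Piece.cut p)) → Run y s₀ (suc k) (mergedHole m)
  Run-extend {y} {s₀} {k} run p fits m = record
    { wellFormed = WellFormed-extend y s₀ k m (Run.wellFormed run) (Run.holeInside run) (Piece.isNode p) (Piece.cutBelow p)
    ; holeInside = HoleInside-extend y s₀ k m (Run.holeInside run) (Piece.cutBelow p)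
    ; sized      = ≤-trans (proj₁ (Run.sized run)) (≤-trans (m≤m+n _ _) (≤-reflexive (sym ∣new∣))) ,
                   ≤-trans (≤-reflexive ∣new∣) fits
    }
    where
    ∣new∣ = ∣extend∣ y s₀ k m (Run.holeInside run) (Piece.cutBelow p)

  record Grouped {y s} (f : Addr → ℕ) (bound : ℕ) (ps : Pieces y s) : Set where
    field
      clusters   : List Cluster
      covers     : ∀ w → multiplicity clusters w ≡ f w + piecesAt ps w
      wellFormed : All WellFormed clusters
      sized      : All Sized clusters
      few        : length clusters * K ≤ bound

  -- Bound on K times the number of groups formed from a run of c nodes followed by pieces of total
  -- size M with H holes: a run is closed only when the next piece would push it beyond K nodes or
  -- bring a second hole.
  groupBound : ℕ → ℕ → ℕ → ℕ
  groupBound c M H = c + 2 * M + K + K * (H ∸ 1)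

  groupBound-extend : ∀ c o M a b H → groupBound (c + o) M (a + b + H) ≤ groupBound c (o + M) (a + (b + H))
  groupBound-extend c o M a b H rewrite +-assoc a b H =
    +-monoˡ-≤ (K * ((a + (b + H)) ∸ 1)) (+-monoˡ-≤ K (≤-trans (m≤m+n (c + o + 2 * M) o) (≤-reflexive (eq c o M))))
    where
    eq : ∀ c o M → c + o + 2 * M + o ≡ c + 2 * (o + M)
    eq = solve 3 (λ c o M → c :+ o :+ con 2 :* M :+ o := c :+ con 2 :* (o :+ M)) refl

  groupBound-overflow : ∀ c o M a b H → K ≤ c + o →
    K + groupBound o M (b + H) ≤ groupBound c (o + M) (a + (b + H))
  groupBound-overflow c o M a b H K≤c+o =
    ≤-trans (≤-reflexive (eq₁ K o M (K * ((b + H) ∸ 1))))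
      (+-mono-≤ (+-monoˡ-≤ K (≤-trans (+-monoˡ-≤ (2 * M) (+-monoˡ-≤ o K≤c+o)) (≤-reflexive (eq₂ c o M))))
                (*-monoʳ-≤ K (∸-monoˡ-≤ 1 (m≤n+m (b + H) a))))
    where
    eq₁ : ∀ K o M Z → K + (o + 2 * M + K + Z) ≡ K + o + 2 * M + K + Z
    eq₁ = solve 4 (λ K o M Z → K :+ (o :+ con 2 :* M :+ K :+ Z) := K :+ o :+ con 2 :* M :+ K :+ Z) refl
    eq₂ : ∀ c o M → c + o + o + 2 * M ≡ c + 2 * (o + M)
    eq₂ = solve 3 (λ c o M → c :+ o :+ o :+ con 2 :* M := c :+ con 2 :* (o :+ M)) refl

  groupBound-second-hole : ∀ c o M H → K + groupBound o M (1 + H) ≤ groupBound c (o + M) (1 + (1 + H))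
  groupBound-second-hole c o M H =
    ≤-trans (≤-reflexive (eq₁ K o M H)) (≤-trans (m≤n+m _ (c + o)) (≤-reflexive (eq₂ c o M K H)))
    where
    eq₁ : ∀ K o M H → K + (o + 2 * M + K + K * H) ≡ o + 2 * M + (K + K * (1 + H))
    eq₁ = solve 4 (λ K o M H → K :+ (o :+ con 2 :* M :+ K :+ K :* H) := o :+ con 2 :* M :+ (K :+ K :* (con 1 :+ H))) refl
    eq₂ : ∀ c o M K H → c + o + (o + 2 * M + (K + K * (1 + H))) ≡ c + 2 * (o + M) + K + K * (1 + H)
    eq₂ = solve 5 (λ c o M K H → c :+ o :+ (o :+ con 2 :* M :+ (K :+ K :* (con 1 :+ H)))
                                   := c :+ con 2 :* (o :+ M) :+ K :+ K :* (con 1 :+ H)) refl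

  close-run : ∀ {y s₀ k X bound bound′} → Run y s₀ k X → (p : Piece (y ++ [ s₀ + k ])) {ps : Pieces y (suc (s₀ + k))} →
    Grouped (λ w → toℕ (⟦ siblings y (s₀ + k) 1 (Piece.cut p) ⟧ w)) bound ps → K + bound ≤ bound′ →
    Grouped (λ w → toℕ (⟦ siblings y s₀ k X ⟧ w)) bound′ (p ∷ ps)
  close-run {y} {s₀} {k} {X} run p {ps} rest bound≤ = record
    { clusters   = siblings y s₀ k X ∷ clusters
    ; covers     = λ w → cong (toℕ (⟦ siblings y s₀ k X ⟧ w) +_)
                     (trans (covers w) (cong (_+ piecesAt ps w) (⟦single⟧ y (s₀ + k) (Piece.cut p) w)))
    ; wellFormed = Run.wellFormed run ∷ wellFormed
    ; sized      = Run.sized run ∷ sized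
    ; few        = ≤-trans (+-monoʳ-≤ K few) bound≤
    }
    where open Grouped rest

  extend-run : ∀ {y s₀ k X bound bound′} → HoleInside y s₀ k X → (p : Piece (y ++ [ s₀ + k ]))
    (m : AtMostOneHole X (Piece.cut p)) {ps : Pieces y (suc (s₀ + k))} →
    Grouped (λ w → toℕ (⟦ siblings y s₀ (suc k) (mergedHole m) ⟧ w)) bound ps → bound ≤ bound′ →
    Grouped (λ w → toℕ (⟦ siblings y s₀ k X ⟧ w)) bound′ (p ∷ ps)
  extend-run {y} {s₀} {k} {X} X-inside p m {ps} rest bound≤ = record
    { clusters   = clusters
    ; covers     = λ w → trans (covers w)
                     (trans (cong (_+ piecesAt ps w) (⟦⟧-extend y s₀ k m X-inside (Piece.cutBelow p) w))
                            (+-assoc (toℕ (⟦ siblings y s₀ k X ⟧ w)) _ (piecesAt ps w)))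
    ; wellFormed = wellFormed
    ; sized      = sized
    ; few        = ≤-trans few bound≤
    }
    where open Grouped rest

  greedy : ∀ y s₀ k X s → s₀ + k ≡ s → Run y s₀ k X → (ps : Pieces y s) →
    Grouped (λ w → toℕ (⟦ siblings y s₀ k X ⟧ w))
            (groupBound (∣ siblings y s₀ k X ∣) (piecesSize ps) (holeCount X + piecesHoles ps)) ps
  greedy y s₀ k X s _ run [] = record
    { clusters   = [ siblings y s₀ k X ]
    ; covers     = λ _ → refl
    ; wellFormed = Run.wellFormed run ∷ []
    ; sized      = Run.sized run ∷ []
    ; few        = ≤-trans (≤-reflexive (+-identityʳ K))
                     (≤-trans (m≤n+m K (∣ siblings y s₀ k X ∣ + 2 * 0)) (m≤m+n _ (K * ((holeCount X + 0) ∸ 1))))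
    }
  greedy y s₀ k X .(s₀ + k) refl run (p ∷ ps)
    with ∣ siblings y s₀ k X ∣ + cutSize (y ++ [ s₀ + k ]) (Piece.cut p) ≤? K | atMostOneHole? X (Piece.cut p)
  ... | yes fits | inj₁ m =
    extend-run (Run.holeInside run) p m
      (greedy y s₀ (suc k) (mergedHole m) (suc (s₀ + k)) (+-suc s₀ k) (Run-extend run p fits m) ps) bound≤
    where
    bound≤ : groupBound (∣ siblings y s₀ (suc k) (mergedHole m) ∣) (piecesSize ps) (holeCount (mergedHole m) + piecesHoles ps)
           ≤ groupBound (∣ siblings y s₀ k X ∣) (cutSize (y ++ [ s₀ + k ]) (Piece.cut p) + piecesSize ps)
                        (holeCount X + (holeCount (Piece.cut p) + piecesHoles ps))
    bound≤ rewrite ∣extend∣ y s₀ k m (Run.holeInside run) (Piece.cutBelow p) | holeCount-merged m =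
      groupBound-extend (∣ siblings y s₀ k X ∣) (cutSize (y ++ [ s₀ + k ]) (Piece.cut p)) (piecesSize ps)
                        (holeCount X) (holeCount (Piece.cut p)) (piecesHoles ps)
  ... | no overflow | _ =
    close-run run p (greedy y (s₀ + k) 1 (Piece.cut p) (suc (s₀ + k)) (+-comm (s₀ + k) 1) (Run-single p) ps)
      (subst (λ c → K + groupBound c (piecesSize ps) (holeCount (Piece.cut p) + piecesHoles ps) ≤ bound)
             (sym (∣single∣ y (s₀ + k) (Piece.cut p)))
             (groupBound-overflow (∣ siblings y s₀ k X ∣) o (piecesSize ps) (holeCount X) (holeCount (Piece.cut p))
                                  (piecesHoles ps) (<⇒≤ (≰⇒> overflow))))
    where
    o = cutSize (y ++ [ s₀ + k ]) (Piece.cut p)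
    bound = groupBound (∣ siblings y s₀ k X ∣) (o + piecesSize ps) (holeCount X + (holeCount (Piece.cut p) + piecesHoles ps))
  ... | yes _ | inj₂ (X-hole , p-hole) =
    close-run run p (greedy y (s₀ + k) 1 (Piece.cut p) (suc (s₀ + k)) (+-comm (s₀ + k) 1) (Run-single p) ps) bound≤
    where
    bound≤ : K + groupBound (∣ siblings y (s₀ + k) 1 (Piece.cut p) ∣) (piecesSize ps) (holeCount (Piece.cut p) + piecesHoles ps)
           ≤ groupBound (∣ siblings y s₀ k X ∣) (cutSize (y ++ [ s₀ + k ]) (Piece.cut p) + piecesSize ps)
                        (holeCount X + (holeCount (Piece.cut p) + piecesHoles ps))
    bound≤ rewrite ∣single∣ y (s₀ + k) (Piece.cut p) | X-hole | p-hole =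
      groupBound-second-hole (∣ siblings y s₀ k X ∣) (cutSize (y ++ [ s₀ + k ]) (Piece.cut p)) (piecesSize ps) (piecesHoles ps)

  grouping : ∀ {y s} (ps : Pieces y s) →
    Grouped (λ _ → 0) (2 * piecesSize ps + K + K * (piecesHoles ps ∸ 1)) ps
  grouping []                 = record { clusters = [] ; covers = λ _ → refl ; wellFormed = [] ; sized = [] ; few = z≤n }
  grouping {y} {s} (p ∷ ps) = record
    { clusters   = clusters
    ; covers     = λ w → trans (covers w) (cong (_+ piecesAt ps w) (⟦single⟧ y s (Piece.cut p) w))
    ; wellFormed = wellFormed
    ; sized      = sized
    ; few        = ≤-trans few (+-monoˡ-≤ (K * ((holeCount (Piece.cut p) + piecesHoles ps) ∸ 1))
                     (+-monoˡ-≤ K (≤-trans (≤-reflexive size≡) (c+2M≤ o (piecesSize ps)))))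
    }
    where
    open Grouped (greedy y s 1 (Piece.cut p) (suc s) (+-comm s 1) (Run-single p) ps)
    o = cutSize (y ++ [ s ]) (Piece.cut p)
    size≡ : ∣ siblings y s 1 (Piece.cut p) ∣ + 2 * piecesSize ps ≡ o + 2 * piecesSize ps
    size≡ = cong (_+ 2 * piecesSize ps) (∣single∣ y s (Piece.cut p))
    c+2M≤ : ∀ a b → a + 2 * b ≤ 2 * (a + b)
    c+2M≤ a b = ≤-trans (m≤m+n (a + 2 * b) a) (≤-reflexive (solve 2 (λ a b → a :+ con 2 :* b :+ a := con 2 :* (a :+ b)) refl a b))

  length≤∥∥ : ∀ Cs → All Sized Cs → length Cs ≤ ∥ Cs ∥
  length≤∥∥ []       []               = z≤n
  length≤∥∥ (C ∷ Cs) ((1≤∣C∣ , _) ∷ ss) = +-mono-≤ 1≤∣C∣ (length≤∥∥ Cs ss)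

  firstHole : ∀ {y s} → Pieces y s → Maybe Addr
  firstHole []       = nothing
  firstHole (p ∷ ps) = Piece.cut p <∣> firstHole ps

  firstHole-inside : ∀ {y s} (ps : Pieces y s) → HoleInside y s (siblingCount ps) (firstHole ps)
  firstHole-inside {y} {s} (p ∷ ps) {x} e with Piece.cut p | Piece.cutBelow p
  ... | just _  | cutBelow = cong (_∨ underSiblings y (suc s) (siblingCount ps) x) (cutBelow e)
  ... | nothing | _ with y ++ [ s ] ≼ᵇ x
  ...   | true  = refl
  ...   | false = firstHole-inside ps e

  firstHole-none : ∀ {y s} (ps : Pieces y s) → piecesHoles ps ≡ 0 → firstHole ps ≡ nothing
  firstHole-none []       _ = refl
  firstHole-none (p ∷ ps) e with Piece.cut p
  ... | nothing = firstHole-none ps e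

  holeCount-firstHole : ∀ {y s} (ps : Pieces y s) → piecesHoles ps ≤ 1 → holeCount (firstHole ps) ≡ piecesHoles ps
  holeCount-firstHole []       _  = refl
  holeCount-firstHole (p ∷ ps) le with Piece.cut p
  ... | nothing = holeCount-firstHole ps le
  ... | just _  = cong suc (sym (n≤0⇒n≡0 (≤-pred le)))

  piecesAt-merged : ∀ {y s} (ps : Pieces y s) → piecesHoles ps ≤ 1 → ∀ w →
    piecesAt ps w ≡ toℕ (underSiblings y s (siblingCount ps) w ∧ not (belowHole (firstHole ps) w))
  piecesAt-merged []                 _  w = refl
  piecesAt-merged {y} {s} (p ∷ ps) le w with Piece.cut p | Piece.cutBelow p
  ... | just x | x-below
    rewrite toℕ-underSiblings-suc y s (siblingCount ps) w (not (x ≺ᵇ w))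
          | piecesAt-merged ps (≤-trans (≤-pred le) z≤n) w | firstHole-none ps (n≤0⇒n≡0 (≤-pred le)) =
    cong (toℕ ((y ++ [ s ] ≼ᵇ w) ∧ not (x ≺ᵇ w)) +_) (cong toℕ (∧-cong-true _ (λ e → cong not (sym (later-free e)))))
    where
    later-free : underSiblings y (suc s) (siblingCount ps) w ≡ true → x ≺ᵇ w ≡ false
    later-free e with underSiblings-sound y (suc s) (siblingCount ps) w e
    ... | j , s<j , _ , e₁ = belowHole-apart y j s (just x) w e₁ x-below (λ j≡ → <-irrefl (sym j≡) s<j)
  ... | nothing | _
    rewrite toℕ-underSiblings-suc y s (siblingCount ps) w (not (belowHole (firstHole ps) w))
          | piecesAt-merged ps le w =
    cong (_+ toℕ (underSiblings y (suc s) (siblingCount ps) w ∧ not (belowHole (firstHole ps) w)))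
         (cong toℕ (∧-cong-true _ (λ e → cong not (sym (first-free e)))))
    where
    first-free : y ++ [ s ] ≼ᵇ w ≡ true → belowHole (firstHole ps) w ≡ false
    first-free e with firstHole ps | firstHole-inside ps
    ... | nothing | _        = refl
    ... | just x  | x-inside with underSiblings-sound y (suc s) (siblingCount ps) x (x-inside refl)
    ...   | j , s<j , _ , e₁ = ≺ᵇ-apart y s j w x e e₁ (λ s≡ → <-irrefl s≡ s<j)

holeUnder : Maybe Addr → Addr → ℕ
holeUnder nothing  v = 0
holeUnder (just h) v = toℕ (v ≼ᵇ h)

holeUnder≤1 : ∀ X v → holeUnder X v ≤ 1
holeUnder≤1 nothing  v = z≤n
holeUnder≤1 (just h) v = toℕ≤1 (v ≼ᵇ h)

holeUnderSiblings : Maybe Addr → Addr → ℕ → ℕ → ℕ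
holeUnderSiblings X y s zero    = 0
holeUnderSiblings X y s (suc k) = holeUnder X (y ++ [ s ]) + holeUnderSiblings X y (suc s) k

holeUnderSiblings-underSiblings : ∀ h y s k → holeUnderSiblings (just h) y s k ≡ toℕ (underSiblings y s k h)
holeUnderSiblings-underSiblings h y s zero    = refl
holeUnderSiblings-underSiblings h y s (suc k) = begin
  toℕ (y ++ [ s ] ≼ᵇ h) + holeUnderSiblings (just h) y (suc s) k
    ≡⟨ cong₂ _+_ (cong toℕ (sym (∧-identityʳ _))) (holeUnderSiblings-underSiblings h y (suc s) k) ⟩
  toℕ ((y ++ [ s ] ≼ᵇ h) ∧ true) + toℕ (underSiblings y (suc s) k h)
    ≡⟨ cong (toℕ ((y ++ [ s ] ≼ᵇ h) ∧ true) +_) (cong toℕ (sym (∧-identityʳ _))) ⟩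
  toℕ ((y ++ [ s ] ≼ᵇ h) ∧ true) + toℕ (underSiblings y (suc s) k h ∧ true)
    ≡⟨ sym (toℕ-underSiblings-suc y s k h true) ⟩
  toℕ (underSiblings y s (suc k) h ∧ true)
    ≡⟨ cong toℕ (∧-identityʳ _) ⟩
  toℕ (underSiblings y s (suc k) h) ∎
  where open ≡-Reasoning

holeUnderSiblings≤ : ∀ X y s k → holeUnderSiblings X y s k ≤ holeUnder X y
holeUnderSiblings≤ nothing  y s zero    = z≤n
holeUnderSiblings≤ nothing  y s (suc k) = holeUnderSiblings≤ nothing y (suc s) k
holeUnderSiblings≤ (just h) y s k rewrite holeUnderSiblings-underSiblings h y s k with underSiblings y s k h in e
... | false = z≤n
... | true  rewrite underSiblings-≼ᵇ y s k h e = ≤-refl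

subtreeCut-self : ∀ v w → toℕ (subtreeCut v (just v) w) ≡ toℕ (v == w)
subtreeCut-self v w with v ≼ᵇ w in e
... | false with v == w in e′
...   | false = refl
...   | true with ==-sound v w e′
...     | refl = ⊥-elim (true≢false (trans (sym (≼ᵇ-refl v)) e))
subtreeCut-self v w | true with ≼ᵇ-sound v w e
... | []    , refl rewrite ++-identityʳ v | ==-refl v | ≼ᵇ⇒⊀ᵇ v v (≼ᵇ-refl v) = refl
... | j ∷ q , refl rewrite ≺ᵇ-++ v j q | ==-++-∷ v j q = refl

isHole : Maybe Addr → Addr → Bool
isHole nothing  v = false
isHole (just h) v = h == v

isHole-sound : ∀ X v → isHole X v ≡ true → X ≡ just v
isHole-sound (just h) v e = cong just (==-sound h v e)

belowHole-child : ∀ X v → belowHole X v ≡ false → isHole X v ≡ false → ∀ i → belowHole X (v ++ [ i ]) ≡ false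
belowHole-child nothing  v _ _ i = refl
belowHole-child (just h) v notBelow notHole i rewrite ≺ᵇ-snoc h v i with h ≼ᵇ v in e
... | false = refl
... | true with ≼ᵇ∧⊀ᵇ⇒≡ h v e notBelow
...   | refl = ⊥-elim (true≢false (trans (sym (==-refl h)) notHole))

node-charge : ∀ K M H → K ≤ M ⊎ 2 ≤ H → 3 * K + K * (H ∸ 1) ≤ 3 * M + 2 * K * H
node-charge K M zero          (inj₁ K≤M) = +-mono-≤ (*-monoʳ-≤ 3 K≤M) (≤-reflexive (trans (*-zeroʳ K) (sym (*-zeroʳ (2 * K)))))
node-charge K M (suc zero)    (inj₁ K≤M) = +-mono-≤ (*-monoʳ-≤ 3 K≤M) (≤-trans (≤-reflexive (*-zeroʳ K)) z≤n)
node-charge K M (suc zero)    (inj₂ (s≤s ()))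
node-charge K M (suc (suc H)) _          = begin
  3 * K + K * (1 + H)           ≡⟨ solve 2 (λ K H → con 3 :* K :+ K :* (con 1 :+ H) := con 4 :* K :+ K :* H) refl K H ⟩
  4 * K + K * H                 ≤⟨ m≤n+m _ (3 * M + K * H) ⟩
  3 * M + K * H + (4 * K + K * H) ≡⟨ solve 3 (λ K M H → con 3 :* M :+ K :* H :+ (con 4 :* K :+ K :* H)
                                                        := con 3 :* M :+ con 2 :* K :* (con 2 :+ H)) refl K M H ⟩
  3 * M + 2 * K * (2 + H)       ∎
  where open ≤-Reasoning

closing-charge : ∀ K L G m M ι H → L * K + 2 * K * H ≤ 5 * m + 2 * K * ι → G * K ≤ 2 * M + K + K * (H ∸ 1) →
  K ≤ M ⊎ 2 ≤ H → (L + G) * K + 2 * K * 1 ≤ 5 * (m + M) + 2 * K * ι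
closing-charge K L G m M ι H closed-few groups-few must-close = +-cancelʳ-≤ (2 * K * H) _ _ (begin
  (L + G) * K + 2 * K * 1 + 2 * K * H
    ≡⟨ solve 4 (λ L G K H → (L :+ G) :* K :+ con 2 :* K :* con 1 :+ con 2 :* K :* H
                            := (L :* K :+ con 2 :* K :* H) :+ (G :* K :+ con 2 :* K)) refl L G K H ⟩
  (L * K + 2 * K * H) + (G * K + 2 * K)
    ≤⟨ +-mono-≤ closed-few (+-monoˡ-≤ (2 * K) groups-few) ⟩
  (5 * m + 2 * K * ι) + (2 * M + K + K * (H ∸ 1) + 2 * K)
    ≡⟨ cong ((5 * m + 2 * K * ι) +_) (solve 3 (λ M K Z → con 2 :* M :+ K :+ Z :+ con 2 :* K
                                                        := con 2 :* M :+ (con 3 :* K :+ Z)) refl M K (K * (H ∸ 1))) ⟩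
  (5 * m + 2 * K * ι) + (2 * M + (3 * K + K * (H ∸ 1)))
    ≤⟨ +-monoʳ-≤ (5 * m + 2 * K * ι) (+-monoʳ-≤ (2 * M) (node-charge K M H must-close)) ⟩
  (5 * m + 2 * K * ι) + (2 * M + (3 * M + 2 * K * H))
    ≡⟨ solve 5 (λ m K ι M X → (con 5 :* m :+ con 2 :* K :* ι) :+ (con 2 :* M :+ (con 3 :* M :+ X))
                              := con 5 :* (m :+ M) :+ con 2 :* K :* ι :+ X) refl m K ι M (2 * K * H) ⟩
  5 * (m + M) + 2 * K * ι + 2 * K * H ∎)
  where open ≤-Reasoning

module BottomUp {A : Set} (t : Tree A) (K : ℕ) (K≥1 : 1 ≤ K) (H : Maybe Addr) where
  open ClusterZones t
  open Grouping t K

  cutSize-self : ∀ {v} → Node t v → cutSize v (just v) ≡ 1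
  cutSize-self {v} (_ , at) = trans (sumOver-cong _ _ (nodes t) (λ w _ → subtreeCut-self v w))
                                    (count-== v (nodes t) (nodes-unique t) (nodes-complete t at))

  singletonPiece : ∀ {v} → Node t v → Piece v
  singletonPiece {v} nd = record
    { cut      = just v
    ; isNode   = nd
    ; cutBelow = λ { refl → ≼ᵇ-refl v }
    ; nonempty = ≤-reflexive (sym (cutSize-self nd))
    ; small    = ≤-trans (≤-reflexive (cutSize-self nd)) K≥1
    }

  -- The 2K charged for an open hole pays for the groups formed when that hole is closed off
  -- higher up; only the hole of the zone itself may stay open at no cost.
  record Clustering (v : Addr) : Set where
    field
      closed     : List Cluster
      pending    : Piece v
      covers     : ∀ w → Node t w →
                   multiplicity closed w + toℕ (subtreeCut v (Piece.cut pending) w) ≡ toℕ (subtreeCut v H w)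
      wellFormed : All WellFormed closed
      sized      : All Sized closed
      few        : length closed * K + 2 * K * holeCount (Piece.cut pending) ≤ 5 * ∥ closed ∥ + 2 * K * holeUnder H v

  Clusterings : Addr → ℕ → Set
  Clusterings = Siblings Clustering

  closedOf : ∀ {y s} → Clusterings y s → List Cluster
  closedOf []       = []
  closedOf (c ∷ cs) = Clustering.closed c ++ closedOf cs

  pendingOf : ∀ {y s} → Clusterings y s → Pieces y s
  pendingOf = mapSiblings Clustering.pending

  closedOf-wellFormed : ∀ {y s} (cs : Clusterings y s) → All WellFormed (closedOf cs)
  closedOf-wellFormed []       = []
  closedOf-wellFormed (c ∷ cs) = All.++⁺ (Clustering.wellFormed c) (closedOf-wellFormed cs)

  closedOf-sized : ∀ {y s} (cs : Clusterings y s) → All Sized (closedOf cs)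
  closedOf-sized []       = []
  closedOf-sized (c ∷ cs) = All.++⁺ (Clustering.sized c) (closedOf-sized cs)

  closedOf-covers : ∀ {y s} (cs : Clusterings y s) w → Node t w →
    multiplicity (closedOf cs) w + piecesAt (pendingOf cs) w ≡ toℕ (underSiblings y s (siblingCount cs) w ∧ not (belowHole H w))
  closedOf-covers             []       w nd = refl
  closedOf-covers {y} {s} (c ∷ cs) w nd rewrite multiplicity-++ (Clustering.closed c) (closedOf cs) w =
    begin
      multiplicity closed w + multiplicity (closedOf cs) w + (toℕ (subtreeCut (y ++ [ s ]) (Piece.cut pending) w) + piecesAt (pendingOf cs) w)
        ≡⟨ solve 4 (λ a b c d → a :+ b :+ (c :+ d) := (a :+ c) :+ (b :+ d)) refl
                   (multiplicity closed w) (multiplicity (closedOf cs) w) (toℕ (subtreeCut (y ++ [ s ]) (Piece.cut pending) w)) (piecesAt (pendingOf cs) w) ⟩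
      (multiplicity closed w + toℕ (subtreeCut (y ++ [ s ]) (Piece.cut pending) w)) + (multiplicity (closedOf cs) w + piecesAt (pendingOf cs) w)
        ≡⟨ cong₂ _+_ (covers w nd) (closedOf-covers cs w nd) ⟩
      toℕ (subtreeCut (y ++ [ s ]) H w) + toℕ (underSiblings y (suc s) (siblingCount cs) w ∧ not (belowHole H w))
        ≡⟨ sym (toℕ-underSiblings-suc y s (siblingCount cs) w (not (belowHole H w))) ⟩
      toℕ (underSiblings y s (suc (siblingCount cs)) w ∧ not (belowHole H w)) ∎
    where
    open Clustering c
    open ≡-Reasoning

  closedOf-few : ∀ {y s} (cs : Clusterings y s) →
    length (closedOf cs) * K + 2 * K * piecesHoles (pendingOf cs)
      ≤ 5 * ∥ closedOf cs ∥ + 2 * K * holeUnderSiblings H y s (siblingCount cs)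
  closedOf-few []       = ≤-reflexive (trans (*-zeroʳ (2 * K)) (sym (*-zeroʳ (2 * K))))
  closedOf-few (c ∷ cs) rewrite length-++ (Clustering.closed c) {closedOf cs} | ∥∥-++ (Clustering.closed c) (closedOf cs) =
    ≤-trans (≤-reflexive (split (length closed) (length (closedOf cs)) K _ _))
      (≤-trans (+-mono-≤ few (closedOf-few cs)) (≤-reflexive (join ∥ closed ∥ ∥ closedOf cs ∥ K _ _)))
    where
    open Clustering c
    split : ∀ a b K c d → (a + b) * K + 2 * K * (c + d) ≡ (a * K + 2 * K * c) + (b * K + 2 * K * d)
    split = solve 5 (λ a b K c d → (a :+ b) :* K :+ con 2 :* K :* (c :+ d)
                                   := (a :* K :+ con 2 :* K :* c) :+ (b :* K :+ con 2 :* K :* d)) refl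
    join : ∀ a b K c d → (5 * a + 2 * K * c) + (5 * b + 2 * K * d) ≡ 5 * (a + b) + 2 * K * (c + d)
    join = solve 5 (λ a b K c d → (con 5 :* a :+ con 2 :* K :* c) :+ (con 5 :* b :+ con 2 :* K :* d)
                                  := con 5 :* (a :+ b) :+ con 2 :* K :* (c :+ d)) refl

  subtree-split : ∀ v {a cs} → At t v (node a cs) → ∀ w → Node t w → ∀ c →
    toℕ ((v ≼ᵇ w) ∧ c) ≡ toℕ ((v == w) ∧ c) + toℕ (underSiblings v 0 (length cs) w ∧ c)
  subtree-split v {cs = cs} at w (_ , at-w) c with v ≼ᵇ w in e
  ... | false with v == w in e′ | underSiblings v 0 (length cs) w in e″
  ...   | false | false = refl
  ...   | true  | _ with ==-sound v w e′
  ...     | refl = ⊥-elim (true≢false (trans (sym (≼ᵇ-refl v)) e))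
  subtree-split v {cs = cs} at w (_ , at-w) c | false | false | true =
    ⊥-elim (true≢false (trans (sym (underSiblings-≼ᵇ v 0 (length cs) w e″)) e))
  subtree-split v {cs = cs} at w (_ , at-w) c | true with ≼ᵇ-sound v w e
  ... | []    , refl rewrite ++-identityʳ v | ==-refl v | underSiblings-self v 0 (length cs) = sym (+-identityʳ (toℕ c))
  ... | j ∷ q , refl rewrite ==-++-∷ v j q
    | underSiblings-complete v 0 (length cs) (v ++ j ∷ q) j z≤n (At-child-< v j q at at-w) (child≼ᵇ-++ v j q) = refl

  subtreeCut-split : ∀ v {a cs} → At t v (node a cs) → ∀ X → belowHole X v ≡ false → ∀ w → Node t w →
    toℕ (subtreeCut v X w) ≡ toℕ (v == w) + toℕ (underSiblings v 0 (length cs) w ∧ not (belowHole X w))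
  subtreeCut-split v {cs = cs} at X notBelow w nd =
    trans (subtree-split v at w nd (not (belowHole X w)))
          (cong (_+ toℕ (underSiblings v 0 (length cs) w ∧ not (belowHole X w))) (root-kept (v == w) refl))
    where
    root-kept : ∀ b → v == w ≡ b → toℕ (b ∧ not (belowHole X w)) ≡ toℕ b
    root-kept false _ = refl
    root-kept true  e with ==-sound v w e
    ... | refl rewrite notBelow = refl

  atHole : ∀ {v} → Node t v → H ≡ just v → Clustering v
  atHole {v} nd H≡ = record
    { closed     = []
    ; pending    = singletonPiece nd
    ; covers     = λ w _ → cong (λ X → toℕ (subtreeCut v X w)) (sym H≡)
    ; wellFormed = []
    ; sized      = []
    ; few        = ≤-reflexive (cong (2 * K *_) (sym (trans (cong (λ X → holeUnder X v) H≡) (cong toℕ (≼ᵇ-refl v)))))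
    }

  module Combine (v : Addr) {a chs} (at : At t v (node a chs)) (notBelow : belowHole H v ≡ false)
                 (cs : Clusterings v 0) (count≡ : siblingCount cs ≡ length chs) where

    pieces : Pieces v 0
    pieces = pendingOf cs

    nd : Node t v
    nd = node a chs , at

    count≡′ : siblingCount pieces ≡ length chs
    count≡′ = trans (siblingCount-map Clustering.pending cs) count≡

    children-covers : ∀ w → Node t w →
      toℕ (subtreeCut v H w) ≡ toℕ (v == w) + (multiplicity (closedOf cs) w + piecesAt pieces w)
    children-covers w nd-w = trans (subtreeCut-split v at H notBelow w nd-w)
      (cong (toℕ (v == w) +_) (sym (trans (closedOf-covers cs w nd-w)
        (cong (λ k → toℕ (underSiblings v 0 k w ∧ not (belowHole H w))) count≡))))

    children-few : length (closedOf cs) * K + 2 * K * piecesHoles pieces ≤ 5 * ∥ closedOf cs ∥ + 2 * K * holeUnder H v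
    children-few = ≤-trans (closedOf-few cs)
      (+-monoʳ-≤ (5 * ∥ closedOf cs ∥) (*-monoʳ-≤ (2 * K) (holeUnderSiblings≤ H v 0 (siblingCount cs))))

    keep-open : suc (piecesSize pieces) ≤ K → piecesHoles pieces ≤ 1 → Clustering v
    keep-open fits oneHole = record
      { closed     = closedOf cs
      ; pending    = record
        { cut      = X
        ; isNode   = nd
        ; cutBelow = X-below
        ; nonempty = ≤-trans (s≤s z≤n) (≤-reflexive (sym size≡))
        ; small    = ≤-trans (≤-reflexive size≡) fits
        }
      ; covers     = covers
      ; wellFormed = closedOf-wellFormed cs
      ; sized      = closedOf-sized cs
      ; few        = subst (λ h → length (closedOf cs) * K + 2 * K * h ≤ 5 * ∥ closedOf cs ∥ + 2 * K * holeUnder H v)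
                           (sym (holeCount-firstHole pieces oneHole)) children-few
      }
      where
      X = firstHole pieces
      X-below : HoleBelow v X
      X-below e = underSiblings-≼ᵇ v 0 (siblingCount pieces) _ (firstHole-inside pieces e)
      pending-split : ∀ w → Node t w → toℕ (subtreeCut v X w) ≡ toℕ (v == w) + piecesAt pieces w
      pending-split w nd-w = trans (subtreeCut-split v at X (belowHole-root v X X-below) w nd-w)
        (cong (toℕ (v == w) +_) (sym (trans (piecesAt-merged pieces oneHole w)
          (cong (λ k → toℕ (underSiblings v 0 k w ∧ not (belowHole X w))) count≡′))))
      size≡ : cutSize v X ≡ suc (piecesSize pieces)
      size≡ = trans (sumOver-cong _ _ (nodes t) (λ w p → pending-split w (nodes-sound t p)))
        (trans (sumOver-+ (λ w → toℕ (v == w)) (piecesAt pieces) (nodes t))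
          (cong₂ _+_ (count-== v (nodes t) (nodes-unique t) (nodes-complete t at)) (sumOver-piecesAt pieces)))
      covers : ∀ w → Node t w → multiplicity (closedOf cs) w + toℕ (subtreeCut v X w) ≡ toℕ (subtreeCut v H w)
      covers w nd-w rewrite pending-split w nd-w | children-covers w nd-w =
        solve 3 (λ a b c → a :+ (b :+ c) := b :+ (a :+ c)) refl
          (multiplicity (closedOf cs) w) (toℕ (v == w)) (piecesAt pieces w)

    close : K ≤ piecesSize pieces ⊎ 2 ≤ piecesHoles pieces → Clustering v
    close must-close = record
      { closed     = closedOf cs ++ clusters
      ; pending    = singletonPiece nd
      ; covers     = covers′
      ; wellFormed = All.++⁺ (closedOf-wellFormed cs) wellFormed
      ; sized      = All.++⁺ (closedOf-sized cs) sized
      ; few        = few′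
      }
      where
      open Grouped (grouping pieces)
      covers′ : ∀ w → Node t w →
        multiplicity (closedOf cs ++ clusters) w + toℕ (subtreeCut v (just v) w) ≡ toℕ (subtreeCut v H w)
      covers′ w nd-w rewrite multiplicity-++ (closedOf cs) clusters w | covers w | subtreeCut-self v w
                           | children-covers w nd-w =
        solve 3 (λ a b c → a :+ b :+ c := c :+ (a :+ b)) refl
          (multiplicity (closedOf cs) w) (piecesAt pieces w) (toℕ (v == w))
      ∥clusters∥ : ∥ clusters ∥ ≡ piecesSize pieces
      ∥clusters∥ = trans (∥∥-multiplicity clusters)
        (trans (sumOver-cong _ _ (nodes t) (λ w _ → covers w)) (sumOver-piecesAt pieces))
      few′ : length (closedOf cs ++ clusters) * K + 2 * K * 1 ≤ 5 * ∥ closedOf cs ++ clusters ∥ + 2 * K * holeUnder H v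
      few′ rewrite length-++ (closedOf cs) {clusters} | ∥∥-++ (closedOf cs) clusters | ∥clusters∥ =
        closing-charge K (length (closedOf cs)) (length clusters) ∥ closedOf cs ∥ (piecesSize pieces)
          (holeUnder H v) (piecesHoles pieces) children-few few must-close

    combine : Clustering v
    combine with suc (piecesSize pieces) ≤? K | piecesHoles pieces ≤? 1
    ... | yes fits | yes oneHole = keep-open fits oneHole
    ... | no  big  | _           = close (inj₁ (≤-pred (≰⇒> big)))
    ... | yes _    | no  holes   = close (inj₂ (≰⇒> holes))

  mutual
    clustering : (v : Addr) (u : Tree A) → At t v u → belowHole H v ≡ false → Clustering v
    clustering v (node a cs) at notBelow with isHole H v in e
    ... | true  = atHole (node a cs , at) (isHole-sound H v e)
    ... | false = Combine.combine v at notBelow (clusteringChildren v 0 cs children-at children-kept)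
                    (siblingCount-clusteringChildren v 0 cs children-at children-kept)
      where
      children-at : ∀ {j c} → ChildAt cs j c → At t (v ++ [ 0 + j ]) c
      children-at ch = At-child v at ch
      children-kept : ∀ {j c} → ChildAt cs j c → belowHole H (v ++ [ 0 + j ]) ≡ false
      children-kept {j} _ = belowHole-child H v notBelow e j

    clusteringChildren : (v : Addr) (i : ℕ) (cs : List (Tree A)) →
      (∀ {j c} → ChildAt cs j c → At t (v ++ [ i + j ]) c) →
      (∀ {j c} → ChildAt cs j c → belowHole H (v ++ [ i + j ]) ≡ false) → Clusterings v i
    clusteringChildren v i []       _      _    = []
    clusteringChildren v i (c ∷ cs) at-cs kept =
      clustering (v ++ [ i ]) c (subst (λ z → At t (v ++ [ z ]) c) (+-identityʳ i) (at-cs here))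
                 (subst (λ z → belowHole H (v ++ [ z ]) ≡ false) (+-identityʳ i) (kept here))
      ∷ clusteringChildren v (suc i) cs
          (λ {j} {c′} ch → subst (λ z → At t (v ++ [ z ]) c′) (+-suc i j) (at-cs (there ch)))
          (λ {j} ch → subst (λ z → belowHole H (v ++ [ z ]) ≡ false) (+-suc i j) (kept (there ch)))

    siblingCount-clusteringChildren : (v : Addr) (i : ℕ) (cs : List (Tree A)) →
      (at-cs : ∀ {j c} → ChildAt cs j c → At t (v ++ [ i + j ]) c) →
      (kept : ∀ {j c} → ChildAt cs j c → belowHole H (v ++ [ i + j ]) ≡ false) →
      siblingCount (clusteringChildren v i cs at-cs kept) ≡ length cs
    siblingCount-clusteringChildren v i []       _ _ = refl
    siblingCount-clusteringChildren v i (c ∷ cs) _ _ = cong suc (siblingCount-clusteringChildren v (suc i) cs _ _)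

top-charge : ∀ K L G m M ι H → L * K + 2 * K * H ≤ 5 * m + 2 * K * ι → G * K ≤ 2 * M + K + K * (H ∸ 1) →
  ι ≤ 1 → (L + G) * K ≤ 5 * (m + M) + 3 * K
top-charge K L G m M ι H closed-few groups-few ι≤1 = +-cancelʳ-≤ (2 * K * H) _ _ (begin
  (L + G) * K + 2 * K * H
    ≡⟨ solve 4 (λ L G K H → (L :+ G) :* K :+ con 2 :* K :* H := (L :* K :+ con 2 :* K :* H) :+ G :* K) refl L G K H ⟩
  (L * K + 2 * K * H) + G * K
    ≤⟨ +-mono-≤ (≤-trans closed-few (+-monoʳ-≤ (5 * m) (*-monoʳ-≤ (2 * K) ι≤1))) groups-few ⟩
  (5 * m + 2 * K * 1) + (2 * M + K + K * (H ∸ 1))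
    ≤⟨ +-monoʳ-≤ (5 * m + 2 * K * 1) (+-monoʳ-≤ (2 * M + K) Z≤) ⟩
  (5 * m + 2 * K * 1) + (2 * M + K + 2 * K * H)
    ≤⟨ m≤n+m _ (3 * M) ⟩
  3 * M + ((5 * m + 2 * K * 1) + (2 * M + K + 2 * K * H))
    ≡⟨ solve 4 (λ m K M X → con 3 :* M :+ ((con 5 :* m :+ con 2 :* K :* con 1) :+ (con 2 :* M :+ K :+ X))
                            := con 5 :* (m :+ M) :+ con 3 :* K :+ X) refl m K M (2 * K * H) ⟩
  5 * (m + M) + 3 * K + 2 * K * H ∎)
  where
  open ≤-Reasoning
  Z≤ : K * (H ∸ 1) ≤ 2 * K * H
  Z≤ = ≤-trans (*-monoʳ-≤ K (m∸n≤m H 1))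
         (≤-trans (m≤m+n (K * H) (K * H)) (≤-reflexive (solve 2 (λ K H → K :* H :+ K :* H := con 2 :* K :* H) refl K H)))

module ZonePartition {A : Set} (t : Tree A) (K : ℕ) (K≥1 : 1 ≤ K) where
  open ClusterZones t
  open Grouping t K

  record Partitioned (C : Cluster) : Set where
    field
      parts      : List Cluster
      covers     : ∀ w → Node t w → multiplicity parts w ≡ toℕ (⟦ C ⟧ w)
      wellFormed : All WellFormed parts
      sized      : All Sized parts
      few        : length parts * K ≤ 5 * ∣ C ∣ + 3 * K

  ∥parts∥ : ∀ Cs C → (∀ w → Node t w → multiplicity Cs w ≡ toℕ (⟦ C ⟧ w)) → ∥ Cs ∥ ≡ ∣ C ∣
  ∥parts∥ Cs C covers = trans (∥∥-multiplicity Cs) (sumOver-cong _ _ (nodes t) (λ w p → covers w (nodes-sound t p)))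

  partition-wholeTree : ∀ X → Partitioned (wholeTree X)
  partition-wholeTree X = record
    { parts      = closed ++ [ rest ]
    ; covers     = covers′
    ; wellFormed = All.++⁺ wellFormed (tt ∷ [])
    ; sized      = All.++⁺ sized ((nonempty , small) ∷ [])
    ; few        = few′
    }
    where
    open BottomUp t K K≥1 X using (Clustering; clustering)
    open Clustering (clustering [] t root (belowHole-[] X))
    open Piece pending
    rest = wholeTree cut
    covers′ : ∀ w → Node t w → multiplicity (closed ++ [ rest ]) w ≡ toℕ (⟦ wholeTree X ⟧ w)
    covers′ w nd rewrite multiplicity-++ closed [ rest ] w | +-identityʳ (toℕ (⟦ rest ⟧ w)) = covers w nd
    ∥closed∥≤ : ∥ closed ∥ ≤ ∣ wholeTree X ∣
    ∥closed∥≤ = ≤-trans (m≤m+n ∥ closed ∥ ∥ [ rest ] ∥)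
      (≤-reflexive (trans (sym (∥∥-++ closed [ rest ])) (∥parts∥ (closed ++ [ rest ]) (wholeTree X) covers′)))
    few′ : length (closed ++ [ rest ]) * K ≤ 5 * ∣ wholeTree X ∣ + 3 * K
    few′ = begin
      length (closed ++ [ rest ]) * K
        ≡⟨ trans (cong (_* K) (length-++ closed)) (*-distribʳ-+ K (length closed) 1) ⟩
      length closed * K + 1 * K
        ≤⟨ +-monoˡ-≤ (1 * K) (≤-trans (m≤m+n _ (2 * K * holeCount cut)) few) ⟩
      5 * ∥ closed ∥ + 2 * K * holeUnder X [] + 1 * K
        ≤⟨ +-monoˡ-≤ (1 * K) (+-mono-≤ (*-monoʳ-≤ 5 ∥closed∥≤) (*-monoʳ-≤ (2 * K) (holeUnder≤1 X []))) ⟩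
      5 * ∣ wholeTree X ∣ + 2 * K * 1 + 1 * K
        ≡⟨ solve 2 (λ c K → con 5 :* c :+ con 2 :* K :* con 1 :+ con 1 :* K := con 5 :* c :+ con 3 :* K) refl
                   ∣ wholeTree X ∣ K ⟩
      5 * ∣ wholeTree X ∣ + 3 * K ∎
      where open ≤-Reasoning

  partition-siblings : ∀ y s k X → WellFormed (siblings y s k X) → Partitioned (siblings y s k X)
  partition-siblings y s zero    X (() , _)
  partition-siblings y s (suc k) X (1≤k , roots) = record
    { parts      = closedOf below ++ clusters
    ; covers     = covers′
    ; wellFormed = All.++⁺ (closedOf-wellFormed below) wellFormed
    ; sized      = All.++⁺ (closedOf-sized below) sized
    ; few        = few′
    }
    where
    open BottomUp t K K≥1 X using (closedOf; pendingOf; closedOf-covers; closedOf-few; closedOf-wellFormed; closedOf-sized;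
                                   clusteringChildren; siblingCount-clusteringChildren)
    parent = At-parent y (s + 0) (proj₂ (proj₁ (roots 0 1≤k)))
    cs = proj₁ (proj₂ parent)
    at-y = proj₁ (proj₂ (proj₂ parent))
    last< : s + k < length cs
    last< = At-child-< y (s + k) [] at-y (proj₂ (proj₁ (roots k ≤-refl)))
    slice = take (suc k) (drop s cs)
    at-slice : ∀ {j c} → ChildAt slice j c → At t (y ++ [ s + j ]) c
    at-slice ch = At-child y at-y (slice-ChildAt s (suc k) cs ch)
    kept : ∀ {j c} → ChildAt slice j c → belowHole X (y ++ [ s + j ]) ≡ false
    kept {j} ch = proj₂ (roots j (slice-index-< s (suc k) cs ch))
    below = clusteringChildren y s slice at-slice kept
    count≡ : siblingCount below ≡ suc k
    count≡ = trans (siblingCount-clusteringChildren y s slice at-slice kept)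
                   (length-slice s (suc k) cs (subst (_≤ length cs) (sym (+-suc s k)) last<))
    open Grouped (grouping (pendingOf below))
    covers′ : ∀ w → Node t w → multiplicity (closedOf below ++ clusters) w ≡ toℕ (⟦ siblings y s (suc k) X ⟧ w)
    covers′ w nd rewrite multiplicity-++ (closedOf below) clusters w | covers w =
      trans (closedOf-covers below w nd) (cong (λ n → toℕ (underSiblings y s n w ∧ not (belowHole X w))) count≡)
    ∥clusters∥ : ∥ clusters ∥ ≡ piecesSize (pendingOf below)
    ∥clusters∥ = trans (∥∥-multiplicity clusters)
      (trans (sumOver-cong _ _ (nodes t) (λ w _ → covers w)) (sumOver-piecesAt (pendingOf below)))
    few′ : length (closedOf below ++ clusters) * K ≤ 5 * ∣ siblings y s (suc k) X ∣ + 3 * K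
    few′ rewrite sym (∥parts∥ (closedOf below ++ clusters) (siblings y s (suc k) X) covers′)
               | length-++ (closedOf below) {clusters} | ∥∥-++ (closedOf below) clusters | ∥clusters∥ =
      top-charge K (length (closedOf below)) (length clusters) ∥ closedOf below ∥ (piecesSize (pendingOf below))
        (holeUnderSiblings X y s (siblingCount below)) (piecesHoles (pendingOf below))
        (closedOf-few below) few (≤-trans (holeUnderSiblings≤ X y s (siblingCount below)) (holeUnder≤1 X y))

  partition : ∀ C → WellFormed C → Partitioned C
  partition (wholeTree X)      _  = partition-wholeTree X
  partition (siblings y s k X) wf = partition-siblings y s k X wf

^-distribʳ-* : ∀ a b h → (a * b) ^ h ≡ a ^ h * b ^ h
^-distribʳ-* a b zero    = refl
^-distribʳ-* a b (suc h) rewrite ^-distribʳ-* a b h =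
  solve 4 (λ a b x y → a :* b :* (x :* y) := a :* x :* (b :* y)) refl a b (a ^ h) (b ^ h)

integer-root : ∀ h .{{_ : NonZero h}} N → Σ ℕ λ K → K ^ h ≤ N × N < suc K ^ h
integer-root h@(suc _) zero = 0 , z≤n , ≤-reflexive (sym (^-zeroˡ h))
integer-root h (suc N) with integer-root h N
... | K , K^h≤N , N<[1+K]^h with suc K ^ h ≤? suc N
...   | yes grown = suc K , grown , ≤-<-trans N<[1+K]^h (^-monoˡ-< h (n<1+n (suc K)))
...   | no  small = K , ≤-trans K^h≤N (n≤1+n N) , ≰⇒> small

root-positive : ∀ h N K → 1 ≤ N → N < suc K ^ h → 1 ≤ K
root-positive h N zero    1≤N N<1 = ⊥-elim (<-irrefl refl (≤-trans (s≤s 1≤N) (≤-trans N<1 (≤-reflexive (^-zeroˡ h)))))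
root-positive h N (suc K) _   _   = s≤s z≤n

parts-bound-large : ∀ h n K f m L → 1 ≤ n → 4 ≤ K → m ^ h ≤ n ^ suc L → n ^ L < suc K ^ h →
  f * K ≤ 8 * m → f ^ h ≤ 10 ^ h * n
parts-bound-large h n K f m L n≥1 K≥4 m^h≤ n^L< fK≤8m =
  *-cancelʳ-≤ (f ^ h) (10 ^ h * n) (8 ^ h * n ^ L) {{m*n≢0 (8 ^ h) (n ^ L) {{m^n≢0 8 h}} {{m^n≢0 n L {{>-nonZero n≥1}}}}}} (begin
    f ^ h * (8 ^ h * n ^ L)         ≤⟨ *-monoʳ-≤ (f ^ h) (*-monoʳ-≤ (8 ^ h) (<⇒≤ n^L<)) ⟩
    f ^ h * (8 ^ h * suc K ^ h)     ≡⟨ cong (f ^ h *_) (sym (^-distribʳ-* 8 (suc K) h)) ⟩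
    f ^ h * (8 * suc K) ^ h         ≡⟨ sym (^-distribʳ-* f (8 * suc K) h) ⟩
    (f * (8 * suc K)) ^ h           ≤⟨ ^-monoˡ-≤ h (*-monoʳ-≤ f 8[1+K]≤10K) ⟩
    (f * (10 * K)) ^ h              ≡⟨ cong (_^ h) (solve 2 (λ f K → f :* (con 10 :* K) := con 10 :* (f :* K)) refl f K) ⟩
    (10 * (f * K)) ^ h              ≤⟨ ^-monoˡ-≤ h (*-monoʳ-≤ 10 fK≤8m) ⟩
    (10 * (8 * m)) ^ h              ≡⟨ trans (^-distribʳ-* 10 (8 * m) h) (cong (10 ^ h *_) (^-distribʳ-* 8 m h)) ⟩
    10 ^ h * (8 ^ h * m ^ h)        ≤⟨ *-monoʳ-≤ (10 ^ h) (*-monoʳ-≤ (8 ^ h) m^h≤) ⟩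
    10 ^ h * (8 ^ h * (n * n ^ L))  ≡⟨ solve 4 (λ a b c d → a :* (b :* (c :* d)) := a :* c :* (b :* d)) refl
                                              (10 ^ h) (8 ^ h) n (n ^ L) ⟩
    10 ^ h * n * (8 ^ h * n ^ L)    ∎)
  where
  open ≤-Reasoning
  8[1+K]≤10K : 8 * suc K ≤ 10 * K
  8[1+K]≤10K = begin
    8 * suc K   ≡⟨ solve 1 (λ K → con 8 :* (con 1 :+ K) := con 8 :+ con 8 :* K) refl K ⟩
    8 + 8 * K   ≤⟨ +-monoˡ-≤ (8 * K) (*-monoʳ-≤ 2 K≥4) ⟩
    2 * K + 8 * K ≡⟨ solve 1 (λ K → con 2 :* K :+ con 8 :* K := con 10 :* K) refl K ⟩
    10 * K      ∎

-- With K = ⌊n^(L/h)⌋, a zone of m ≤ n^((L+1)/h) nodes cut into f parts of total charge f·K ≤ 5m + 3K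
-- has f ≤ 10 n^(1/h).
parts-bound : ∀ h n K f m L → 1 ≤ n → m ^ h ≤ n ^ suc L → n ^ L < suc K ^ h →
  f * K ≤ 5 * m + 3 * K → f ≤ m → f ^ h ≤ 10 ^ h * n
parts-bound h n K f m L n≥1 m^h≤ n^L< fK≤ f≤m with K <? 4 | m ≤? K
... | yes K<4 | _ = begin
  f ^ h           ≤⟨ ^-monoˡ-≤ h f≤m ⟩
  m ^ h           ≤⟨ m^h≤ ⟩
  n * n ^ L       ≤⟨ *-monoʳ-≤ n (≤-trans (<⇒≤ n^L<) (^-monoˡ-≤ h (≤-trans K<4 (m≤m+n 4 6)))) ⟩
  n * 10 ^ h      ≡⟨ *-comm n (10 ^ h) ⟩
  10 ^ h * n      ∎
  where open ≤-Reasoning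
... | no K≮4 | yes m≤K = begin
  f ^ h           ≤⟨ ^-monoˡ-≤ h (≤-trans f≤8 (m≤m+n 8 2)) ⟩
  10 ^ h          ≤⟨ m≤m*n (10 ^ h) n {{>-nonZero n≥1}} ⟩
  10 ^ h * n      ∎
  where
  open ≤-Reasoning
  f≤8 : f ≤ 8
  f≤8 = *-cancelʳ-≤ f 8 K {{>-nonZero (≤-trans (s≤s z≤n) (≮⇒≥ K≮4))}}
    (≤-trans fK≤ (≤-trans (+-monoˡ-≤ (3 * K) (*-monoʳ-≤ 5 m≤K))
      (≤-reflexive (solve 1 (λ K → con 5 :* K :+ con 3 :* K := con 8 :* K) refl K))))
... | no K≮4 | no m≰K = parts-bound-large h n K f m L n≥1 (≮⇒≥ K≮4) m^h≤ n^L<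
  (≤-trans fK≤ (≤-trans (+-monoʳ-≤ (5 * m) (*-monoʳ-≤ 3 (<⇒≤ (≰⇒> m≰K))))
    (≤-reflexive (solve 1 (λ m → con 5 :* m :+ con 3 :* m := con 8 :* m) refl m))))

0^h≡0 : ∀ h .{{_ : NonZero h}} → 0 ^ h ≡ 0
0^h≡0 (suc h) = refl

count-true : ∀ L → count (λ _ → true) L ≡ length L
count-true []      = refl
count-true (_ ∷ L) = cong suc (count-true L)

module Hierarchy {A : Set} (t : Tree A) (n h : ℕ) .{{_ : NonZero h}} (n≥1 : 1 ≤ n) where
  open ClusterZones t

  HierarchyFor : ℕ → Cluster → Set
  HierarchyFor ℓ C = Σ Hier λ H → IsPH t n h ℓ H × Bounded n h 10 H × top H ≡ ⟦ C ⟧ᴺ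

  HierarchiesFor : ℕ → List Cluster → Set
  HierarchiesFor ℓ Cs = Σ (List Hier) λ Hs →
    TopsDenote Hs Cs × All (IsPH t n h ℓ) Hs × All (Bounded n h 10) Hs × length Hs ≡ length Cs

  -- ⌊n^((ℓ+1)/h)⌋, the size bound of the (ℓ+1)-zones.
  blockSize : ℕ → ℕ
  blockSize ℓ = proj₁ (integer-root h (n ^ suc ℓ))

  blockSize-positive : ∀ ℓ → 1 ≤ blockSize ℓ
  blockSize-positive ℓ = root-positive h (n ^ suc ℓ) (blockSize ℓ) (m^n>0 n {{>-nonZero n≥1}} (suc ℓ))
                                       (proj₂ (proj₂ (integer-root h (n ^ suc ℓ))))

  module Level (ℓ : ℕ) = ZonePartition t (blockSize ℓ) (blockSize-positive ℓ)

  size-⟦⟧ᴺ : ∀ C → length ⟦ C ⟧ᴺ ≡ ∣ C ∣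
  size-⟦⟧ᴺ C = length-filterᵇ ⟦ C ⟧ (nodes t)

  parts-small : ∀ ℓ C wf → All (λ P → ∣ P ∣ ^ h ≤ n ^ suc ℓ) (Level.Partitioned.parts {ℓ = ℓ} (Level.partition ℓ C wf))
  parts-small ℓ C wf = All.map (λ P-sized → ≤-trans (^-monoˡ-≤ h (proj₂ P-sized)) (proj₁ (proj₂ (integer-root h (n ^ suc ℓ)))))
                               (Level.Partitioned.sized {ℓ = ℓ} (Level.partition ℓ C wf))

  assemble : ∀ ℓ C (wf : WellFormed C) → ∣ C ∣ ^ h ≤ n ^ suc (suc ℓ) →
    HierarchiesFor (suc ℓ) (Level.Partitioned.parts {ℓ = ℓ} (Level.partition ℓ C wf)) → HierarchyFor (suc (suc ℓ)) C
  assemble ℓ C wf C-small (Hs , ds , phs , bds , length≡) =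
    mk ⟦ C ⟧ᴺ Hs ,
    phS (⟦⟧-zone C wf , subst (λ k → k ^ h ≤ n ^ suc (suc ℓ)) (sym (size-⟦⟧ᴺ C)) C-small)
        (partition-by-multiplicity ⟦ C ⟧ ds covers) phs ,
    bnd (subst (λ k → k ^ h ≤ 10 ^ h * n) (sym length≡) few′) bds ,
    refl
    where
    open Level.Partitioned ℓ (Level.partition ℓ C wf)
    few′ : length parts ^ h ≤ 10 ^ h * n
    few′ = parts-bound h n (blockSize ℓ) (length parts) ∣ C ∣ (suc ℓ) n≥1 C-small
             (proj₂ (proj₂ (integer-root h (n ^ suc ℓ)))) few
             (≤-trans (Grouping.length≤∥∥ t (blockSize ℓ) parts sized) (≤-reflexive (Level.∥parts∥ ℓ parts C covers)))

  mutual
    build : ∀ ℓ → 1 ≤ ℓ → ∀ C → WellFormed C → ∣ C ∣ ^ h ≤ n ^ ℓ → HierarchyFor ℓ C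
    build (suc zero)    _ C wf C-small =
      mk ⟦ C ⟧ᴺ [] ,
      ph1 (⟦⟧-zone C wf , subst (λ k → k ^ h ≤ n ^ 1) (sym (size-⟦⟧ᴺ C)) C-small) ,
      bnd (≤-trans (≤-reflexive (0^h≡0 h)) z≤n) [] ,
      refl
    build (suc (suc ℓ)) _ C wf C-small =
      assemble ℓ C wf C-small (buildAll (suc ℓ) (s≤s z≤n) parts wellFormed (parts-small ℓ C wf))
      where open Level.Partitioned ℓ (Level.partition ℓ C wf)

    buildAll : ∀ ℓ → 1 ≤ ℓ → ∀ Cs → All WellFormed Cs → All (λ C → ∣ C ∣ ^ h ≤ n ^ ℓ) Cs → HierarchiesFor ℓ Cs
    buildAll ℓ 1≤ℓ []       []         []           = [] , [] , [] , [] , refl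
    buildAll ℓ 1≤ℓ (C ∷ Cs) (wf ∷ wfs) (small ∷ smalls)
      with build ℓ 1≤ℓ C wf small | buildAll ℓ 1≤ℓ Cs wfs smalls
    ... | H , ph , bd , top≡ | Hs , ds , phs , bds , length≡ = H ∷ Hs , top≡ ∷ ds , ph ∷ phs , bd ∷ bds , cong suc length≡

proposition2 : {A : Set} (h : ℕ) → 1 ≤ h → (n : ℕ) (t : Tree A) → size t ≤ n →
    ∃ λ H → IsPH t n h h H × Bounded n h 10 H × (∀ v → Node t v → v ∈ top H)
proposition2 h h≥1 n t@(node _ _) size≤n with Hierarchy.build t n h {{>-nonZero h≥1}} n≥1 h h≥1 (wholeTree nothing) tt whole-small
  where
  n≥1 : 1 ≤ n
  n≥1 = ≤-trans (s≤s z≤n) size≤n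
  whole-small : ClusterZones.∣_∣ t (wholeTree nothing) ^ h ≤ n ^ h
  whole-small = ^-monoˡ-≤ h (≤-trans (≤-reflexive (trans (count-true (nodes t)) (length-nodes t))) size≤n)
... | H , ph , bd , top≡ = H , ph , bd , λ v nd → subst (v ∈_) (sym top≡) (ClusterZones.∈-nodesWhere⁺ t _ nd refl)
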